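{- For every integer $k\geq 1$ there exist finitely many peg permutations $\alpha_{(1)}^{\varepsilon^1},\ldots,\alpha_{(N)}^{\varepsilon^N}$ (with $N=N(k)$), each of which is clean compact, has length $2k+1$ and satisfies $rd(\alpha_{(j)}^{\varepsilon^j})=k$, such that $$B_k^{(rd)}=\bigcup_{j=1}^{N}\mathrm{Grid}(\alpha_{(j)}^{\varepsilon^j})\qquad\text{and}\qquad \hat{B}_k^{(rd)}=\bigcup_{j=1}^{N}\mathrm{Grid}_{peg}(\alpha_{(j)}^{\varepsilon^j}).$$
   Context: Permutations are written in one-line notation. A peg permutation of length $n$ is a word $\pi_1^{\varepsilon_1}\cdots\pi_n^{\varepsilon_n}$ where $\pi=\pi_1\cdots\pi_n$ is a permutation of $\{1,\dots,n\}$ (the underlying permutation) and each decoration $\varepsilon_i\in\{+,-,\bullet\}$. An increasing strip is a maximal factor (set of consecutive positions) $\pi_i^{\varepsilon_i}\cdots\pi_{i+m-1}^{\varepsilon_{i+m-1}}$ with $\pi_{j+1}=\pi_j+1$ for consecutive positions in it and all its entries decorated $+$ or $\bullet$; a decreasing strip is defined likewise with $\pi_{j+1}=\pi_j-1$ and all decorations $-$ or $\bullet$; a strip is an increasing or decreasing strip. A peg permutation is clean compact if all its strips have length $1$. An identity peg permutation has identity underlying permutation and all decorations in $\{+,\bullet\}$. For a standard permutation, a reversal replaces a factor $\pi_i\pi_{i+1}\cdots\pi_j$ by $\pi_j\cdots\pi_{i+1}\pi_i$; $rd(\pi)$ is the minimum number of reversals transforming $\pi$ into the identity, and $B_k^{(rd)}$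 is the set of all permutations (of all lengths) with $rd\le k$. For a peg permutation, a reversal reverses a factor and moreover swaps $+\leftrightarrow -$ on the reversed entries ($\bullet$ unchanged); $rd(\pi^\varepsilon)$ is the minimum number of such reversals transforming $\pi^\varepsilon$ into an identity peg permutation of the same length, and $\hat B_k^{(rd)}$ is the set of all peg permutations with $rd\le k$. Monotone inflation: for a peg permutation $\pi^\varepsilon$ of length $n$, a vector $v=(v_1,\dots,v_n)$ of nonnegative integers is legal if $v_i\in\{0,1\}$ whenever $\varepsilon_i=\bullet$. The monotone inflation $\pi^\varepsilon[v]$ is the permutation obtained by replacing each $\pi_i$ by a block of $v_i$ entries forming an increasing run of consecutive values if $\varepsilon_i=+$, a decreasing run of consecutive values if $\varepsilon_i=-$, and a single entry (or nothing if $v_i=0$) if $\varepsilon_i=\bullet$, the values being chosen so that all entries of block $i$ are smaller than all entries of block $j$ whenever $\pi_i<\pi_j$. $\mathrm{Grid}(\pi^\varepsilon)$ is the set of all monotone inflations of $\pi^\varepsilon$ over legal vectors. Peg monotone inflations are defined the same way except that the block replacing a $+$ entry is an increasing run of consecutive values each decorated $+$ or $\bullet$, the block replacing a $-$ entry is a decreasing run of consecutive values each decorated $-$ or $\bullet$, and a $\bullet$ entry with $v_i=1$ stays a single entry decorated $\bullet$; $\mathrm{Grid}_{peg}(\pi^\varepsilon)$ is the set of all peg permutations so obtained. -}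

module Defs where

open import Data.Nat using (ℕ; zero; suc; _+_; _∸_; _≤_; _<_; _<ᵇ_)
open import Data.Bool using (if_then_else_)
open import Data.List using (List; []; _∷_; length; upTo; take; drop; reverse; _++_; map; concat; zipWith; replicate; applyUpTo)
open import Data.List.Relation.Binary.Permutation.Propositional using (_↭_)
open import Data.List.Relation.Binary.Pointwise using (Pointwise)
open import Data.List.Relation.Unary.All using (All)
open import Data.Product using (_×_; _,_; proj₁; proj₂; ∃)
open import Data.Nat.ListAction using (sum)
open import Data.Empty using (⊥)
open import Data.Unit using (⊤)
open import Relation.Binary.PropositionalEquality using (_≡_; _≢_)
open import Relation.Nullary using (¬_)

-- CONVENTION: values are 0-based, i.e. a permutation of length n is a
-- rearrangement of 0,1,…,n-1 (the paper uses 1,…,n; this is a relabelling).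

Word : Set
Word = List ℕ

IsPerm : Word → Set
IsPerm xs = xs ↭ upTo (length xs)

IsIdentity : Word → Set
IsIdentity xs = xs ≡ upTo (length xs)

-- Reversal of the factor occupying positions i, …, j-1 (0-based, i ≤ j).
rev : ℕ → ℕ → Word → Word
rev i j xs = take i xs ++ reverse (take (j ∸ i) (drop i xs)) ++ drop j xs

data RdLe : ℕ → Word → Set where
  done : ∀ {k xs} → IsIdentity xs → RdLe k xs
  step : ∀ {k xs} i j → i ≤ j → RdLe k (rev i j xs) → RdLe (suc k) xs

InB : ℕ → Word → Set
InB k π = IsPerm π × RdLe k π

data Deco : Set where
  plus minus bullet : Deco

PegWord : Set
PegWord = List (ℕ × Deco)

underlying : PegWord → Word
underlying = map proj₁

decos : PegWord → List Deco
decos = map proj₂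

IsPegPerm : PegWord → Set
IsPegPerm α = IsPerm (underlying α)

flipDeco : Deco → Deco
flipDeco plus = minus
flipDeco minus = plus
flipDeco bullet = bullet

flipEntry : ℕ × Deco → ℕ × Deco
flipEntry (a , d) = (a , flipDeco d)

pegRev : ℕ → ℕ → PegWord → PegWord
pegRev i j xs = take i xs ++ map flipEntry (reverse (take (j ∸ i) (drop i xs))) ++ drop j xs

IsIdentityPeg : PegWord → Set
IsIdentityPeg α = IsIdentity (underlying α) × All (λ d → d ≢ minus) (decos α)

data PegRdLe : ℕ → PegWord → Set where
  done : ∀ {k α} → IsIdentityPeg α → PegRdLe k α
  step : ∀ {k α} i j → i ≤ j → PegRdLe k (pegRev i j α) → PegRdLe (suc k) α

PegRdEq : ℕ → PegWord → Set
PegRdEq k α = PegRdLe k α × (∀ m → m < k → ¬ PegRdLe m α)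

InBHat : ℕ → PegWord → Set
InBHat k α = IsPegPerm α × PegRdLe k α

-- Strips / clean compactness.
-- IncOK / DecOK: decoration allowed in an increasing / decreasing strip.

IncOK : Deco → Set
IncOK minus = ⊥
IncOK _ = ⊤

DecOK : Deco → Set
DecOK plus = ⊥
DecOK _ = ⊤

-- A strip of length ≥ 2 exists iff two adjacent entries form an
-- increasing (b = a+1, both in {+,•}) or decreasing (a = b+1, both in
-- {-,•}) factor of length 2.  Clean compact = all strips have length 1
-- = no such adjacent pair.
CleanCompact : PegWord → Set
CleanCompact [] = ⊤
CleanCompact (_ ∷ []) = ⊤
CleanCompact ((a , d) ∷ (b , e) ∷ rest) =
  ¬ (b ≡ suc a × IncOK d × IncOK e) ×
  ¬ (a ≡ suc b × DecOK d × DecOK e) ×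
  CleanCompact ((b , e) ∷ rest)

LegalEntry : ℕ × Deco → ℕ → Set
LegalEntry (_ , bullet) w = w ≤ 1
LegalEntry (_ , _) w = ⊤

Legal : PegWord → List ℕ → Set
Legal α v = Pointwise LegalEntry α v

offset : PegWord → List ℕ → ℕ → ℕ
offset α v a = sum (zipWith (λ x w → if proj₁ x <ᵇ a then w else 0) α v)

block : Deco → ℕ → ℕ → Word
block minus o w = reverse (applyUpTo (o +_) w)
block _     o w = applyUpTo (o +_) w

inflate : PegWord → List ℕ → Word
inflate α v = concat (zipWith (λ x w → block (proj₂ x) (offset α v (proj₁ x)) w) α v)

InGrid : PegWord → Word → Set
InGrid α π = ∃ λ v → Legal α v × π ≡ inflate α v

Compat : Deco → Deco → Set
Compat plus e = e ≢ minus
Compat minus e = e ≢ plus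
Compat bullet e = e ≡ bullet

parentDecos : PegWord → List ℕ → List Deco
parentDecos α v = concat (zipWith (λ x w → replicate w (proj₂ x)) α v)

InGridPeg : PegWord → PegWord → Set
InGridPeg α β = ∃ λ v → Legal α v × underlying β ≡ inflate α v
                        × Pointwise Compat (parentDecos α v) (decos β)

module Submission where

-- Peg inflation commutes with reversal: reversing a factor made of whole blocks of α
-- reverses a factor of the inflation and swaps + and −. Hence every inflation of a peg
-- permutation with rd ≤ k has rd ≤ k. Conversely, a β with rd ≤ k arises from an
-- identity, which lies in the grid of (0 , +), by k reversals. If δ lies in the grid of
-- a clean compact α of length 2k+1 with rd ≤ k, replace the bullets of α by signs and
-- split the two blocks containing the cut points of the next reversal; that reversal
-- then reverses whole blocks of a word of length 2k+3, and the result is again clean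
-- compact because each split pair is a strip whose continuation the reversal breaks.
-- A reversal changes the number of breakpoints (adjacent pairs that are not strips) by
-- at most two, so a clean compact word of length 2k+1 has rd ≥ k. Finally, the words
-- of length 2k+1 are finitely many and the conditions are decidable.

open import Defs
open import Algebra.Definitions using (Involutive)
open import Data.Bool using (true; false; if_then_else_)
open import Data.Empty using (⊥-elim)
open import Data.List using (List; []; _∷_; [_]; length; take; drop; reverse; _++_; map; concat; zipWith; replicate; applyUpTo; upTo; filter; cartesianProduct; cartesianProductWith)
open import Data.List.Properties using (length-map; length-++; length-reverse; length-replicate; length-applyUpTo; length-take; map-++; map-∘; map-id; map-cong; map-replicate; reverse-++; reverse-map; reverse-involutive; unfold-reverse; ++-assoc; ++-identityʳ; take-[]; drop-[]; take-map; drop-map; take++drop≡id; concat-++; applyUpTo-∷ʳ; ∷-injectiveˡ; ∷-injectiveʳ; zipWith-cong; zipWith-zeroˡ; zipWith-zeroʳ; ≡-dec)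
open import Data.List.Membership.Propositional using (_∈_; lose; find)
import Data.List.Membership.Propositional.Properties as ∈
open import Data.List.Relation.Binary.Permutation.Propositional using (_↭_; ↭-sym; ↭-trans; ↭-reflexive)
import Data.List.Relation.Binary.Permutation.Propositional.Properties as ↭
open import Data.List.Relation.Binary.Pointwise as Pointwise using (Pointwise; []; _∷_)
open import Data.List.Relation.Binary.Pointwise.Properties using (Pointwise-length)
open import Data.List.Relation.Unary.All as All using (All; []; _∷_; all?)
import Data.List.Relation.Unary.All.Properties as All
open import Data.List.Relation.Unary.AllPairs using (AllPairs; []; _∷_)
open import Data.List.Relation.Unary.Any using (Any; here; there; any?; satisfied)
import Data.List.Relation.Unary.Unique.Propositional.Properties as Unique
open import Data.Nat using (ℕ; zero; suc; pred; _+_; _*_; _∸_; _≤_; _<_; _⊓_; z≤n; s≤s; _<ᵇ_; _≟_; _≤?_)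
open import Data.Nat.ListAction using (sum)
open import Data.Nat.ListAction.Properties using (sum-++; sum-↭)
open import Data.Nat.Properties using (≤-refl; ≤-reflexive; ≤-trans; ≤-<-connex; <⇒≤; <⇒≱; n≤1+n; m≤n⇒m≤1+n; m≤m+n; m≤n+m; +-assoc; +-comm; +-identityʳ; +-suc; +-mono-≤; +-monoˡ-≤; +-monoʳ-≤; +-cancelˡ-≤; *-suc; *-cancelˡ-≤; +-∸-assoc; m+[n∸m]≡n; m+n∸m≡n; m+n∸n≡m; m∸n+n≡m; n∸n≡0; m≤n⇒m∸n≡0; ∸-monoˡ-≤; ⊓-zeroʳ; ⊓-monoˡ-≤; m⊓n≤n; m≤n⇒m⊓n≡m; m≥n⇒m⊓n≡n; module ≤-Reasoning)
open import Data.Product using (Σ; ∃; _×_; _,_; proj₁; proj₂)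
open import Data.Sum using (_⊎_; inj₁; inj₂)
open import Data.Unit using (tt)
open import Function.Bundles using (_⇔_; mk⇔)
open import Relation.Nullary using (¬_; Dec; yes; no)
open import Relation.Nullary.Decidable using (_×-dec_; _⊎-dec_; ¬?)
open import Relation.Binary.PropositionalEquality using (_≡_; _≢_; refl; sym; trans; cong; cong₂; subst; subst₂; module ≡-Reasoning)

revWith : ∀ {A : Set} → (A → A) → ℕ → ℕ → List A → List A
revWith f i j xs = take i xs ++ map f (reverse (take (j ∸ i) (drop i xs))) ++ drop j xs

rev≡revWith-id : ∀ i j (xs : Word) → rev i j xs ≡ revWith (λ x → x) i j xs
rev≡revWith-id i j xs = cong (λ m → take i xs ++ m ++ drop j xs) (sym (map-id _))

module _ {A : Set} where

  take++factor++drop : ∀ i j (xs : List A) → i ≤ j → xs ≡ take i xs ++ take (j ∸ i) (drop i xs) ++ drop j xs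
  take++factor++drop zero j xs le = sym (take++drop≡id j xs)
  take++factor++drop (suc i) (suc j) [] le rewrite take-[] {A = A} (j ∸ i) = refl
  take++factor++drop (suc i) (suc j) (x ∷ xs) (s≤s le) = cong (x ∷_) (take++factor++drop i j xs le)

  take-length-++ : ∀ (xs ys : List A) → take (length xs) (xs ++ ys) ≡ xs
  take-length-++ [] ys = refl
  take-length-++ (x ∷ xs) ys = cong (x ∷_) (take-length-++ xs ys)

  drop-length-++ : ∀ (xs ys : List A) → drop (length xs) (xs ++ ys) ≡ ys
  drop-length-++ [] ys = refl
  drop-length-++ (x ∷ xs) ys = drop-length-++ xs ys

  length-map-reverse : ∀ (f : A → A) xs → length (map f (reverse xs)) ≡ length xs
  length-map-reverse f xs = trans (length-map f (reverse xs)) (length-reverse xs)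

  revWith-++ : ∀ (f : A → A) (xs ys zs : List A) →
    revWith f (length xs) (length xs + length ys) (xs ++ ys ++ zs) ≡ xs ++ map f (reverse ys) ++ zs
  revWith-++ f [] ys zs = cong₂ (λ a b → map f (reverse a) ++ b) (take-length-++ ys zs) (drop-length-++ ys zs)
  revWith-++ f (x ∷ xs) ys zs = cong (x ∷_) (revWith-++ f xs ys zs)

  revWith-[] : ∀ (f : A → A) i j → revWith f i j [] ≡ []
  revWith-[] f i j rewrite take-[] {A = A} i | drop-[] {A = A} i | take-[] {A = A} (j ∸ i) | drop-[] {A = A} j = refl

  take-⊓-length : ∀ j (xs : List A) → take j xs ≡ take (j ⊓ length xs) xs
  take-⊓-length zero xs = refl
  take-⊓-length (suc j) [] = refl
  take-⊓-length (suc j) (x ∷ xs) = cong (x ∷_) (take-⊓-length j xs)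

  drop-⊓-length : ∀ j (xs : List A) → drop j xs ≡ drop (j ⊓ length xs) xs
  drop-⊓-length zero xs = refl
  drop-⊓-length (suc j) [] = refl
  drop-⊓-length (suc j) (x ∷ xs) = drop-⊓-length j xs

  revWith-⊓-length : ∀ (f : A → A) i j xs → i ≤ j → revWith f i j xs ≡ revWith f (i ⊓ length xs) (j ⊓ length xs) xs
  revWith-⊓-length f zero j xs le = cong₂ (λ a b → map f (reverse a) ++ b) (take-⊓-length j xs) (drop-⊓-length j xs)
  revWith-⊓-length f (suc i) (suc j) [] le = trans (revWith-[] f (suc i) (suc j)) (sym (revWith-[] f 0 0))
  revWith-⊓-length f (suc i) (suc j) (x ∷ xs) (s≤s le) = cong (x ∷_) (revWith-⊓-length f i j xs le)

  length-++-++ : ∀ (xs ys zs : List A) → length (xs ++ ys ++ zs) ≡ length xs + (length ys + length zs)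
  length-++-++ xs ys zs = trans (length-++ xs) (cong (length xs +_) (length-++ ys))

  length-revWith : ∀ (f : A → A) i j xs → i ≤ j → length (revWith f i j xs) ≡ length xs
  length-revWith f i j xs le = begin
    length (take i xs ++ map f (reverse M) ++ drop j xs)
      ≡⟨ length-++-++ (take i xs) _ (drop j xs) ⟩
    length (take i xs) + (length (map f (reverse M)) + length (drop j xs))
      ≡⟨ cong (λ m → length (take i xs) + (m + length (drop j xs))) (length-map-reverse f M) ⟩
    length (take i xs) + (length M + length (drop j xs))
      ≡⟨ sym (length-++-++ (take i xs) M (drop j xs)) ⟩
    length (take i xs ++ M ++ drop j xs)
      ≡⟨ cong length (sym (take++factor++drop i j xs le)) ⟩
    length xs ∎
    where
    open ≡-Reasoning
    M = take (j ∸ i) (drop i xs)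

  map-reverse-involutive : ∀ (f : A → A) → Involutive _≡_ f → ∀ xs → map f (reverse (map f (reverse xs))) ≡ xs
  map-reverse-involutive f inv xs = begin
    map f (reverse (map f (reverse xs)))   ≡⟨ reverse-map f (map f (reverse xs)) ⟩
    reverse (map f (map f (reverse xs)))   ≡⟨ cong reverse (sym (map-∘ (reverse xs))) ⟩
    reverse (map (λ x → f (f x)) (reverse xs)) ≡⟨ cong reverse (trans (map-cong inv (reverse xs)) (map-id (reverse xs))) ⟩
    reverse (reverse xs)                   ≡⟨ reverse-involutive xs ⟩
    xs ∎
    where
    open ≡-Reasoning

  revWith-involutive : ∀ (f : A → A) → Involutive _≡_ f → ∀ i j xs → i ≤ j → revWith f i j (revWith f i j xs) ≡ xs
  revWith-involutive f inv (suc i) (suc j) (x ∷ xs) (s≤s le) = cong (x ∷_) (revWith-involutive f inv i j xs le)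
  revWith-involutive f inv (suc i) (suc j) [] le =
    trans (cong (revWith f (suc i) (suc j)) (revWith-[] f (suc i) (suc j))) (revWith-[] f (suc i) (suc j))
  revWith-involutive f inv zero j xs le = begin
    revWith f 0 j (P ++ D)                       ≡⟨ revWith-⊓-length f 0 j (P ++ D) z≤n ⟩
    revWith f 0 (j ⊓ length (P ++ D)) (P ++ D)   ≡⟨ cong (λ m → revWith f 0 m (P ++ D)) clamped ⟩
    revWith f 0 (length P) (P ++ D)              ≡⟨ revWith-++ f [] P D ⟩
    map f (reverse P) ++ D                       ≡⟨ cong (_++ D) (map-reverse-involutive f inv (take j xs)) ⟩
    take j xs ++ D                               ≡⟨ take++drop≡id j xs ⟩
    xs ∎
    where
    open ≡-Reasoning
    P = map f (reverse (take j xs))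
    D = drop j xs
    clamped : j ⊓ length (P ++ D) ≡ length P
    clamped = begin
      j ⊓ length (P ++ D)        ≡⟨ cong (j ⊓_) (length-revWith f 0 j xs z≤n) ⟩
      j ⊓ length xs              ≡⟨ sym (length-take j xs) ⟩
      length (take j xs)         ≡⟨ sym (length-map-reverse f (take j xs)) ⟩
      length P ∎

module _ {A B : Set} {P : A → B → Set} where

  Pointwise-take : ∀ i {xs ys} → Pointwise P xs ys → Pointwise P (take i xs) (take i ys)
  Pointwise-take zero p = []
  Pointwise-take (suc i) [] = []
  Pointwise-take (suc i) (x ∷ p) = x ∷ Pointwise-take i p

  Pointwise-drop : ∀ i {xs ys} → Pointwise P xs ys → Pointwise P (drop i xs) (drop i ys)
  Pointwise-drop zero p = p
  Pointwise-drop (suc i) [] = []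
  Pointwise-drop (suc i) (x ∷ p) = Pointwise-drop i p

  Pointwise-revWith : ∀ (f : A → A) (g : B → B) → (∀ {x y} → P x y → P (f x) (g y)) →
    ∀ i j {xs ys} → Pointwise P xs ys → Pointwise P (revWith f i j xs) (revWith g i j ys)
  Pointwise-revWith f g h i j p =
    Pointwise.++⁺ (Pointwise-take i p)
      (Pointwise.++⁺ (Pointwise.map⁺ f g (Pointwise.map h (Pointwise.reverse⁺ (Pointwise-take (j ∸ i) (Pointwise-drop i p)))))
        (Pointwise-drop j p))

  Pointwise-++-∷ : ∀ (xs : List A) x zs (ys : List B) y ws → length xs ≡ length ys →
    Pointwise P (xs ++ x ∷ zs) (ys ++ y ∷ ws) → Pointwise P xs ys × P x y × Pointwise P zs ws
  Pointwise-++-∷ [] x zs [] y ws eq (p ∷ ps) = [] , p , ps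
  Pointwise-++-∷ (x' ∷ xs) x zs (y' ∷ ys) y ws eq (p ∷ ps) =
    let (pxs , px , pzs) = Pointwise-++-∷ xs x zs ys y ws (cong pred eq) ps in p ∷ pxs , px , pzs

map-revWith : ∀ {A B : Set} (h : A → B) (f : A → A) (g : B → B) → (∀ x → h (f x) ≡ g (h x)) →
  ∀ i j xs → map h (revWith f i j xs) ≡ revWith g i j (map h xs)
map-revWith h f g hf≡gh i j xs = begin
  map h (take i xs ++ map f (reverse M) ++ drop j xs)
    ≡⟨ trans (map-++ h (take i xs) _) (cong (map h (take i xs) ++_) (map-++ h (map f (reverse M)) (drop j xs))) ⟩
  map h (take i xs) ++ map h (map f (reverse M)) ++ map h (drop j xs)
    ≡⟨ cong (λ m → map h (take i xs) ++ m ++ map h (drop j xs)) middle ⟩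
  map h (take i xs) ++ map g (reverse (map h M)) ++ map h (drop j xs)
    ≡⟨ cong₂ (λ a b → a ++ map g (reverse (map h M)) ++ b) (sym (take-map i xs)) (sym (drop-map j xs)) ⟩
  take i (map h xs) ++ map g (reverse (map h M)) ++ drop j (map h xs)
    ≡⟨ cong (λ m → take i (map h xs) ++ map g (reverse m) ++ drop j (map h xs))
         (trans (sym (take-map (j ∸ i) (drop i xs))) (cong (take (j ∸ i)) (sym (drop-map i xs)))) ⟩
  revWith g i j (map h xs) ∎
  where
  open ≡-Reasoning
  M = take (j ∸ i) (drop i xs)
  middle : map h (map f (reverse M)) ≡ map g (reverse (map h M))
  middle = begin
    map h (map f (reverse M))     ≡⟨ sym (map-∘ (reverse M)) ⟩
    map (λ x → h (f x)) (reverse M) ≡⟨ map-cong hf≡gh (reverse M) ⟩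
    map (λ x → g (h x)) (reverse M) ≡⟨ map-∘ (reverse M) ⟩
    map g (map h (reverse M))     ≡⟨ cong (map g) (reverse-map h M) ⟩
    map g (reverse (map h M)) ∎

flipDeco-involutive : Involutive _≡_ flipDeco
flipDeco-involutive plus = refl
flipDeco-involutive minus = refl
flipDeco-involutive bullet = refl

flipEntry-involutive : Involutive _≡_ flipEntry
flipEntry-involutive (a , d) = cong (a ,_) (flipDeco-involutive d)

pegRev-involutive : ∀ i j α → i ≤ j → pegRev i j (pegRev i j α) ≡ α
pegRev-involutive = revWith-involutive flipEntry flipEntry-involutive

underlying-pegRev : ∀ i j α → underlying (pegRev i j α) ≡ rev i j (underlying α)
underlying-pegRev i j α = trans (map-revWith proj₁ flipEntry (λ x → x) (λ _ → refl) i j α) (sym (rev≡revWith-id i j (underlying α)))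

decos-pegRev : ∀ i j α → decos (pegRev i j α) ≡ revWith flipDeco i j (decos α)
decos-pegRev = map-revWith proj₂ flipEntry flipDeco (λ _ → refl)

module _ {A B C : Set} (F : A → B → C) where

  zipWith-++ : ∀ (xs xs' : List A) (ys ys' : List B) → length xs ≡ length ys →
    zipWith F (xs ++ xs') (ys ++ ys') ≡ zipWith F xs ys ++ zipWith F xs' ys'
  zipWith-++ [] xs' [] ys' eq = refl
  zipWith-++ (x ∷ xs) xs' (y ∷ ys) ys' eq = cong (F x y ∷_) (zipWith-++ xs xs' ys ys' (cong pred eq))

  take-zipWith : ∀ i xs ys → take i (zipWith F xs ys) ≡ zipWith F (take i xs) (take i ys)
  take-zipWith zero xs ys = refl
  take-zipWith (suc i) [] ys = refl
  take-zipWith (suc i) (x ∷ xs) [] = refl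
  take-zipWith (suc i) (x ∷ xs) (y ∷ ys) = cong (F x y ∷_) (take-zipWith i xs ys)

  drop-zipWith : ∀ i xs ys → drop i (zipWith F xs ys) ≡ zipWith F (drop i xs) (drop i ys)
  drop-zipWith zero xs ys = refl
  drop-zipWith (suc i) [] ys = sym (zipWith-zeroˡ F (drop (suc i) ys))
  drop-zipWith (suc i) (x ∷ xs) [] = sym (zipWith-zeroʳ F (drop i xs))
  drop-zipWith (suc i) (x ∷ xs) (y ∷ ys) = drop-zipWith i xs ys

  module _ {P : A → B → Set} (g : A → A) (g′ : B → B) (h : C → C) (F-g : ∀ x y → P x y → F (g x) (g′ y) ≡ h (F x y)) where

    zipWith-map-reverse : ∀ {xs ys} → Pointwise P xs ys →
      zipWith F (map g (reverse xs)) (map g′ (reverse ys)) ≡ map h (reverse (zipWith F xs ys))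
    zipWith-map-reverse [] = refl
    zipWith-map-reverse {x ∷ xs} {y ∷ ys} (p ∷ ps) = begin
      zipWith F (map g (reverse (x ∷ xs))) (map g′ (reverse (y ∷ ys)))
        ≡⟨ cong₂ (zipWith F) (map-snoc g x xs) (map-snoc g′ y ys) ⟩
      zipWith F (map g (reverse xs) ++ [ g x ]) (map g′ (reverse ys) ++ [ g′ y ])
        ≡⟨ zipWith-++ (map g (reverse xs)) _ (map g′ (reverse ys)) _ lengths ⟩
      zipWith F (map g (reverse xs)) (map g′ (reverse ys)) ++ [ F (g x) (g′ y) ]
        ≡⟨ cong₂ (λ a b → a ++ [ b ]) (zipWith-map-reverse ps) (F-g x y p) ⟩
      map h (reverse (zipWith F xs ys)) ++ [ h (F x y) ]
        ≡⟨ sym (map-snoc h (F x y) (zipWith F xs ys)) ⟩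
      map h (reverse (zipWith F (x ∷ xs) (y ∷ ys))) ∎
      where
      open ≡-Reasoning
      map-snoc : ∀ {D : Set} (k : D → D) z zs → map k (reverse (z ∷ zs)) ≡ map k (reverse zs) ++ [ k z ]
      map-snoc k z zs = trans (cong (map k) (unfold-reverse z zs)) (map-++ k (reverse zs) [ z ])
      lengths : length (map g (reverse xs)) ≡ length (map g′ (reverse ys))
      lengths = trans (length-map-reverse g xs) (trans (Pointwise-length ps) (sym (length-map-reverse g′ ys)))

    zipWith-revWith : ∀ i j {xs ys} → Pointwise P xs ys →
      zipWith F (revWith g i j xs) (revWith g′ i j ys) ≡ revWith h i j (zipWith F xs ys)
    zipWith-revWith i j {xs} {ys} ps = begin
      zipWith F (take i xs ++ map g (reverse Mx) ++ drop j xs) (take i ys ++ map g′ (reverse My) ++ drop j ys)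
        ≡⟨ zipWith-++ (take i xs) _ (take i ys) _ (Pointwise-length (Pointwise-take i ps)) ⟩
      zipWith F (take i xs) (take i ys) ++ zipWith F (map g (reverse Mx) ++ drop j xs) (map g′ (reverse My) ++ drop j ys)
        ≡⟨ cong (zipWith F (take i xs) (take i ys) ++_) (zipWith-++ (map g (reverse Mx)) _ (map g′ (reverse My)) _ lengths) ⟩
      zipWith F (take i xs) (take i ys) ++ zipWith F (map g (reverse Mx)) (map g′ (reverse My)) ++ zipWith F (drop j xs) (drop j ys)
        ≡⟨ cong (λ m → zipWith F (take i xs) (take i ys) ++ m ++ zipWith F (drop j xs) (drop j ys)) (zipWith-map-reverse pM) ⟩
      zipWith F (take i xs) (take i ys) ++ map h (reverse (zipWith F Mx My)) ++ zipWith F (drop j xs) (drop j ys)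
        ≡⟨ sym (cong₂ (λ a b → a ++ map h (reverse b) ++ _) (take-zipWith i xs ys) middle) ⟩
      take i Z ++ map h (reverse (take (j ∸ i) (drop i Z))) ++ zipWith F (drop j xs) (drop j ys)
        ≡⟨ cong (λ m → take i Z ++ map h (reverse (take (j ∸ i) (drop i Z))) ++ m) (sym (drop-zipWith j xs ys)) ⟩
      revWith h i j Z ∎
      where
      open ≡-Reasoning
      Z = zipWith F xs ys
      Mx = take (j ∸ i) (drop i xs)
      My = take (j ∸ i) (drop i ys)
      pM : Pointwise P Mx My
      pM = Pointwise-take (j ∸ i) (Pointwise-drop i ps)
      lengths : length (map g (reverse Mx)) ≡ length (map g′ (reverse My))
      lengths = trans (length-map-reverse g Mx) (trans (Pointwise-length pM) (sym (length-map-reverse g′ My)))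
      middle : take (j ∸ i) (drop i Z) ≡ zipWith F Mx My
      middle = trans (cong (take (j ∸ i)) (drop-zipWith i xs ys)) (take-zipWith (j ∸ i) (drop i xs) (drop i ys))

take-split : ∀ {A : Set} i j (xs : List A) → i ≤ j → take j xs ≡ take i xs ++ take (j ∸ i) (drop i xs)
take-split zero j xs le = refl
take-split {A} (suc i) (suc j) [] le rewrite take-[] {A = A} (j ∸ i) = refl
take-split (suc i) (suc j) (x ∷ xs) (s≤s le) = cong (x ∷_) (take-split i j xs le)

revWith-id-↭ : ∀ {A : Set} i j (xs : List A) → i ≤ j → revWith (λ x → x) i j xs ↭ xs
revWith-id-↭ i j xs le = ↭-trans
  (↭.++⁺ˡ (take i xs) (↭.++⁺ʳ (drop j xs) (↭-trans (↭-reflexive (map-id _)) (↭.↭-reverse _))))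
  (↭-reflexive (sym (take++factor++drop i j xs le)))

module _ {B : Set} (f : B → B) where

  concat-map-reverse : ∀ (L : List (List B)) → concat (map (λ b → map f (reverse b)) (reverse L)) ≡ map f (reverse (concat L))
  concat-map-reverse [] = refl
  concat-map-reverse (b ∷ L) = begin
    concat (map mr (reverse (b ∷ L)))              ≡⟨ cong (λ m → concat (map mr m)) (unfold-reverse b L) ⟩
    concat (map mr (reverse L ++ [ b ]))           ≡⟨ cong concat (map-++ mr (reverse L) [ b ]) ⟩
    concat (map mr (reverse L) ++ [ mr b ])        ≡⟨ sym (concat-++ (map mr (reverse L)) [ mr b ]) ⟩
    concat (map mr (reverse L)) ++ mr b ++ []      ≡⟨ cong₂ _++_ (concat-map-reverse L) (++-identityʳ (mr b)) ⟩
    map f (reverse (concat L)) ++ map f (reverse b) ≡⟨ sym (map-++ f (reverse (concat L)) (reverse b)) ⟩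
    map f (reverse (concat L) ++ reverse b)        ≡⟨ cong (map f) (sym (reverse-++ b (concat L))) ⟩
    map f (reverse (b ++ concat L)) ∎
    where
    open ≡-Reasoning
    mr : List B → List B
    mr b = map f (reverse b)

  concat-revWith : ∀ i j (L : List (List B)) → i ≤ j →
    concat (revWith (λ b → map f (reverse b)) i j L) ≡ revWith f (length (concat (take i L))) (length (concat (take j L))) (concat L)
  concat-revWith i j L le = begin
    concat (take i L ++ map mr (reverse M) ++ drop j L)
      ≡⟨ trans (sym (concat-++ (take i L) _)) (cong (concat (take i L) ++_) (sym (concat-++ (map mr (reverse M)) (drop j L)))) ⟩
    concat (take i L) ++ concat (map mr (reverse M)) ++ concat (drop j L)
      ≡⟨ cong (λ m → concat (take i L) ++ m ++ concat (drop j L)) (concat-map-reverse M) ⟩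
    concat (take i L) ++ map f (reverse (concat M)) ++ concat (drop j L)
      ≡⟨ sym (revWith-++ f (concat (take i L)) (concat M) (concat (drop j L))) ⟩
    revWith f I (I + length (concat M)) (concat (take i L) ++ concat M ++ concat (drop j L))
      ≡⟨ cong₂ (revWith f I) lengthJ (trans (cong (concat (take i L) ++_) (concat-++ M (drop j L)))
           (trans (concat-++ (take i L) (M ++ drop j L)) (cong concat (sym (take++factor++drop i j L le))))) ⟩
    revWith f I (length (concat (take j L))) (concat L) ∎
    where
    open ≡-Reasoning
    mr : List B → List B
    mr b = map f (reverse b)
    M = take (j ∸ i) (drop i L)
    I = length (concat (take i L))
    lengthJ : I + length (concat M) ≡ length (concat (take j L))
    lengthJ = sym (trans (cong (λ m → length (concat m)) (take-split i j L le))
      (trans (cong length (sym (concat-++ (take i L) M))) (length-++ (concat (take i L)))))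

length-concat-zipWith : ∀ {A B : Set} {P : A → ℕ → Set} (F : A → ℕ → List B) → (∀ x w → length (F x w) ≡ w) →
  ∀ {xs ws} → Pointwise P xs ws → length (concat (zipWith F xs ws)) ≡ sum ws
length-concat-zipWith F lengthF [] = refl
length-concat-zipWith F lengthF {x ∷ xs} {w ∷ ws} (_ ∷ ps) =
  trans (length-++ (F x w)) (cong₂ _+_ (lengthF x w) (length-concat-zipWith F lengthF ps))

module _ {A B : Set} {P : A → ℕ → Set} (F : A → ℕ → List B) (lengthF : ∀ x w → length (F x w) ≡ w)
  (g : A → A) (f : B → B) (F-g : ∀ x w → P x w → F (g x) w ≡ map f (reverse (F x w))) where

  concat-zipWith-revWith : ∀ i j {xs ws} → i ≤ j → Pointwise P xs ws →
    concat (zipWith F (revWith g i j xs) (revWith (λ w → w) i j ws))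
      ≡ revWith f (sum (take i ws)) (sum (take j ws)) (concat (zipWith F xs ws))
  concat-zipWith-revWith i j {xs} {ws} le ps = begin
    concat (zipWith F (revWith g i j xs) (revWith (λ w → w) i j ws))
      ≡⟨ cong concat (zipWith-revWith F g (λ w → w) (λ b → map f (reverse b)) F-g i j ps) ⟩
    concat (revWith (λ b → map f (reverse b)) i j (zipWith F xs ws))
      ≡⟨ concat-revWith f i j (zipWith F xs ws) le ⟩
    revWith f (prefixLength i) (prefixLength j) (concat (zipWith F xs ws))
      ≡⟨ cong₂ (λ a b → revWith f a b (concat (zipWith F xs ws))) (prefixLength≡ i) (prefixLength≡ j) ⟩
    revWith f (sum (take i ws)) (sum (take j ws)) (concat (zipWith F xs ws)) ∎
    where
    open ≡-Reasoning
    prefixLength : ℕ → ℕ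
    prefixLength k = length (concat (take k (zipWith F xs ws)))
    prefixLength≡ : ∀ k → prefixLength k ≡ sum (take k ws)
    prefixLength≡ k = trans (cong (λ m → length (concat m)) (take-zipWith F k xs ws))
      (length-concat-zipWith F lengthF (Pointwise-take k ps))

-- Inflation commutes with reversing a factor of whole blocks

offsetTerm : ℕ → ℕ × Deco → ℕ → ℕ
offsetTerm a x w = if proj₁ x <ᵇ a then w else 0

blockAt : PegWord → List ℕ → ℕ × Deco → ℕ → Word
blockAt α v x w = block (proj₂ x) (offset α v (proj₁ x)) w

parentBlock : ℕ × Deco → ℕ → List Deco
parentBlock x w = replicate w (proj₂ x)

length-block : ∀ d o w → length (block d o w) ≡ w
length-block plus o w = length-applyUpTo _ w
length-block minus o w = trans (length-reverse (applyUpTo (o +_) w)) (length-applyUpTo _ w)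
length-block bullet o w = length-applyUpTo _ w

block-flip : ∀ x o w → LegalEntry x w → block (flipDeco (proj₂ x)) o w ≡ map (λ y → y) (reverse (block (proj₂ x) o w))
block-flip (a , plus) o w _ = sym (map-id _)
block-flip (a , minus) o w _ = trans (sym (reverse-involutive _)) (sym (map-id _))
block-flip (a , bullet) o zero _ = refl
block-flip (a , bullet) o (suc zero) _ = refl
block-flip (a , bullet) o (suc (suc w)) (s≤s ())

reverse-replicate : ∀ {A : Set} n (x : A) → reverse (replicate n x) ≡ replicate n x
reverse-replicate zero x = refl
reverse-replicate (suc n) x = begin
  reverse (x ∷ replicate n x)     ≡⟨ unfold-reverse x (replicate n x) ⟩
  reverse (replicate n x) ++ [ x ] ≡⟨ cong (_++ [ x ]) (reverse-replicate n x) ⟩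
  replicate n x ++ [ x ]          ≡⟨ replicate-snoc n ⟩
  x ∷ replicate n x ∎
  where
  open ≡-Reasoning
  replicate-snoc : ∀ n → replicate n x ++ [ x ] ≡ x ∷ replicate n x
  replicate-snoc zero = refl
  replicate-snoc (suc n) = cong (x ∷_) (replicate-snoc n)

parentBlock-flip : ∀ x w → parentBlock (flipEntry x) w ≡ map flipDeco (reverse (parentBlock x w))
parentBlock-flip x w = trans (sym (map-replicate flipDeco w (proj₂ x))) (cong (map flipDeco) (sym (reverse-replicate w (proj₂ x))))

LegalEntry-flip : ∀ {x w} → LegalEntry x w → LegalEntry (flipEntry x) w
LegalEntry-flip {_ , plus} l = l
LegalEntry-flip {_ , minus} l = l
LegalEntry-flip {_ , bullet} l = l

module _ {α : PegWord} {v : List ℕ} (legal : Legal α v) {i j : ℕ} (i≤j : i ≤ j) where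

  private
    rev-v : rev i j v ≡ revWith (λ w → w) i j v
    rev-v = rev≡revWith-id i j v

  Legal-pegRev : Legal (pegRev i j α) (rev i j v)
  Legal-pegRev = subst (Legal (pegRev i j α)) (sym rev-v) (Pointwise-revWith flipEntry (λ w → w) LegalEntry-flip i j legal)

  offset-pegRev : ∀ a → offset (pegRev i j α) (rev i j v) a ≡ offset α v a
  offset-pegRev a = begin
    sum (zipWith (offsetTerm a) (pegRev i j α) (rev i j v))
      ≡⟨ cong (λ u → sum (zipWith (offsetTerm a) (pegRev i j α) u)) rev-v ⟩
    sum (zipWith (offsetTerm a) (pegRev i j α) (revWith (λ w → w) i j v))
      ≡⟨ cong sum (zipWith-revWith (offsetTerm a) flipEntry (λ w → w) (λ n → n) (λ _ _ _ → refl) i j legal) ⟩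
    sum (revWith (λ n → n) i j (zipWith (offsetTerm a) α v))
      ≡⟨ sum-↭ (revWith-id-↭ i j _ i≤j) ⟩
    sum (zipWith (offsetTerm a) α v) ∎
    where open ≡-Reasoning

  inflate-pegRev : inflate (pegRev i j α) (rev i j v) ≡ rev (sum (take i v)) (sum (take j v)) (inflate α v)
  inflate-pegRev = begin
    concat (zipWith (blockAt (pegRev i j α) (rev i j v)) (pegRev i j α) (rev i j v))
      ≡⟨ cong concat (zipWith-cong (λ x w → cong (λ o → block (proj₂ x) o w) (offset-pegRev (proj₁ x))) (pegRev i j α) (rev i j v)) ⟩
    concat (zipWith (blockAt α v) (pegRev i j α) (rev i j v))
      ≡⟨ cong (λ u → concat (zipWith (blockAt α v) (pegRev i j α) u)) rev-v ⟩
    concat (zipWith (blockAt α v) (pegRev i j α) (revWith (λ w → w) i j v))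
      ≡⟨ concat-zipWith-revWith (blockAt α v) (λ x w → length-block (proj₂ x) _ w) flipEntry (λ y → y)
           (λ x w → block-flip x _ w) i j i≤j legal ⟩
    revWith (λ y → y) (sum (take i v)) (sum (take j v)) (inflate α v)
      ≡⟨ sym (rev≡revWith-id (sum (take i v)) (sum (take j v)) (inflate α v)) ⟩
    rev (sum (take i v)) (sum (take j v)) (inflate α v) ∎
    where open ≡-Reasoning

  parentDecos-pegRev : parentDecos (pegRev i j α) (rev i j v) ≡ revWith flipDeco (sum (take i v)) (sum (take j v)) (parentDecos α v)
  parentDecos-pegRev = trans (cong (λ u → concat (zipWith parentBlock (pegRev i j α) u)) rev-v)
    (concat-zipWith-revWith parentBlock (λ x w → length-replicate w) flipEntry flipDeco (λ x w _ → parentBlock-flip x w) i j i≤j legal)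

InGridPeg-pegRev : ∀ {α β} (g : InGridPeg α β) → ∀ i j → i ≤ j →
  InGridPeg (pegRev i j α) (pegRev (sum (take i (proj₁ g))) (sum (take j (proj₁ g))) β)
InGridPeg-pegRev {α} {β} (v , legal , β≡ , compat) i j i≤j =
  rev i j v , Legal-pegRev legal i≤j ,
  trans (underlying-pegRev I J β) (trans (cong (rev I J) β≡) (sym (inflate-pegRev legal i≤j))) ,
  subst₂ (Pointwise Compat) (sym (parentDecos-pegRev legal i≤j)) (sym (decos-pegRev I J β))
    (Pointwise-revWith flipDeco flipDeco Compat-flip I J compat)
  where
  I = sum (take i v)
  J = sum (take j v)
  Compat-flip : ∀ {d e} → Compat d e → Compat (flipDeco d) (flipDeco e)
  Compat-flip {plus} {plus} c = λ ()
  Compat-flip {plus} {minus} c = ⊥-elim (c refl)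
  Compat-flip {plus} {bullet} c = λ ()
  Compat-flip {minus} {plus} c = ⊥-elim (c refl)
  Compat-flip {minus} {minus} c = λ ()
  Compat-flip {minus} {bullet} c = λ ()
  Compat-flip {bullet} {bullet} refl = refl

data Consecutive : ℕ → PegWord → Set where
  [] : ∀ {m} → Consecutive m []
  _∷_ : ∀ {m a d α} → a ≡ m → Consecutive (suc m) α → Consecutive m ((a , d) ∷ α)

applyUpTo-cong : ∀ {A : Set} {f g : ℕ → A} → (∀ x → f x ≡ g x) → ∀ n → applyUpTo f n ≡ applyUpTo g n
applyUpTo-cong f≗g zero = refl
applyUpTo-cong f≗g (suc n) = cong₂ _∷_ (f≗g 0) (applyUpTo-cong (λ x → f≗g (suc x)) n)

applyUpTo-++ : ∀ (f : ℕ → ℕ) w t → applyUpTo f w ++ applyUpTo (λ x → f (w + x)) t ≡ applyUpTo f (w + t)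
applyUpTo-++ f zero t = refl
applyUpTo-++ f (suc w) t = cong (f 0 ∷_) (applyUpTo-++ (λ x → f (suc x)) w t)

consecutive : ∀ m (α : PegWord) n → underlying α ≡ applyUpTo (m +_) n → Consecutive m α
consecutive m [] n eq = []
consecutive m ((a , d) ∷ α) (suc n) eq =
  trans (∷-injectiveˡ eq) (+-identityʳ m) ∷ consecutive (suc m) α n (trans (∷-injectiveʳ eq) (applyUpTo-cong (+-suc m) n))

<ᵇ-false : ∀ m a → a ≤ m → (m <ᵇ a) ≡ false
<ᵇ-false m zero le = refl
<ᵇ-false (suc m) (suc a) (s≤s le) = <ᵇ-false m a le

<ᵇ-true : ∀ m a → m < a → (m <ᵇ a) ≡ true
<ᵇ-true zero (suc a) le = refl
<ᵇ-true (suc m) (suc a) (s≤s le) = <ᵇ-true m a le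

offset-consecutive : ∀ {m α} v → Consecutive m α → length α ≡ length v → ∀ a → offset α v a ≡ sum (take (a ∸ m) v)
offset-consecutive {m} [] [] eq a rewrite take-[] {A = ℕ} (a ∸ m) = refl
offset-consecutive {m} (w ∷ v) (refl ∷ c) eq a with ≤-<-connex a m
... | inj₁ a≤m rewrite <ᵇ-false m a a≤m | offset-consecutive v c (cong pred eq) a
      | m≤n⇒m∸n≡0 a≤m | m≤n⇒m∸n≡0 (m≤n⇒m≤1+n a≤m) = refl
... | inj₂ m<a rewrite <ᵇ-true m a m<a | offset-consecutive v c (cong pred eq) a
      | +-∸-assoc 1 m<a = refl

block-no-minus : ∀ d → d ≢ minus → ∀ o w → block d o w ≡ applyUpTo (o +_) w
block-no-minus plus _ o w = refl
block-no-minus minus d≢minus o w = ⊥-elim (d≢minus refl)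
block-no-minus bullet _ o w = refl

concat-blocks-consecutive : ∀ (O : ℕ → ℕ) {m L} vs s → Consecutive m L → length L ≡ length vs →
  All (λ x → proj₂ x ≢ minus) L → (∀ a → m ≤ a → O a ≡ s + sum (take (a ∸ m) vs)) →
  concat (zipWith (λ x w → block (proj₂ x) (O (proj₁ x)) w) L vs) ≡ applyUpTo (s +_) (sum vs)
concat-blocks-consecutive O [] s [] eq noMinus O≡ = refl
concat-blocks-consecutive O {m} {(_ , d) ∷ L} (w ∷ vs) s (refl ∷ c) eq (d≢minus ∷ noMinus) O≡ = begin
  block d (O m) w ++ concat (zipWith _ L vs)
    ≡⟨ cong₂ _++_ (trans (cong (λ o → block d o w) Om≡s) (block-no-minus d d≢minus s w))
         (concat-blocks-consecutive O vs (s + w) c (cong pred eq) noMinus O≡′) ⟩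
  applyUpTo (s +_) w ++ applyUpTo ((s + w) +_) (sum vs)
    ≡⟨ cong (applyUpTo (s +_) w ++_) (applyUpTo-cong (+-assoc s w) (sum vs)) ⟩
  applyUpTo (s +_) w ++ applyUpTo (λ x → s + (w + x)) (sum vs)
    ≡⟨ applyUpTo-++ (s +_) w (sum vs) ⟩
  applyUpTo (s +_) (w + sum vs) ∎
  where
  open ≡-Reasoning
  Om≡s : O m ≡ s
  Om≡s = trans (O≡ m ≤-refl) (trans (cong (λ z → s + sum (take z (w ∷ vs))) (n∸n≡0 m)) (+-identityʳ s))
  O≡′ : ∀ a → suc m ≤ a → O a ≡ (s + w) + sum (take (a ∸ suc m) vs)
  O≡′ a m<a = trans (O≡ a (≤-trans (n≤1+n m) m<a))
    (trans (cong (λ z → s + sum (take z (w ∷ vs))) (+-∸-assoc 1 m<a)) (sym (+-assoc s w _)))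

inflate-identity : ∀ {α v} → IsIdentityPeg α → Legal α v → inflate α v ≡ upTo (length (inflate α v))
inflate-identity {α} {v} (isId , noMinus) legal = trans blocks (cong upTo (trans (sym (length-applyUpTo (λ x → x) (sum v))) (cong length (sym blocks))))
  where
  c = consecutive 0 α (length (underlying α)) isId
  blocks : inflate α v ≡ upTo (sum v)
  blocks = concat-blocks-consecutive (offset α v) v 0 c (Pointwise-length legal) (All.map⁻ noMinus)
    (λ a _ → offset-consecutive v c (Pointwise-length legal) a)

sum-take-mono : ∀ {i j} (v : List ℕ) → i ≤ j → sum (take i v) ≤ sum (take j v)
sum-take-mono {i} {j} v i≤j rewrite take-split i j v i≤j | sum-++ (take i v) (take (j ∸ i) (drop i v)) = m≤m+n _ _

RdLe-inflate : ∀ {k α} → PegRdLe k α → ∀ {v} → Legal α v → RdLe k (inflate α v)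
RdLe-inflate (done isId) legal = done (inflate-identity isId legal)
RdLe-inflate {suc k} {α} (step i j i≤j rd) {v} legal =
  step (sum (take i v)) (sum (take j v)) (sum-take-mono v i≤j)
    (subst (RdLe k) (inflate-pegRev legal i≤j) (RdLe-inflate rd (Legal-pegRev legal i≤j)))

All-parentDecos : ∀ (P : Deco → Set) α v → All P (decos α) → All P (parentDecos α v)
All-parentDecos P [] v _ = []
All-parentDecos P (x ∷ α) [] _ = []
All-parentDecos P (x ∷ α) (w ∷ v) (p ∷ ps) = All.++⁺ (All.replicate⁺ w p) (All-parentDecos P α v ps)

Compat-no-minus : ∀ {ds es} → Pointwise Compat ds es → All (_≢ minus) ds → All (_≢ minus) es
Compat-no-minus [] [] = []
Compat-no-minus {plus ∷ _} (c ∷ cs) (_ ∷ ns) = c ∷ Compat-no-minus cs ns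
Compat-no-minus {minus ∷ _} (c ∷ cs) (n ∷ ns) = ⊥-elim (n refl)
Compat-no-minus {bullet ∷ _} (refl ∷ cs) (_ ∷ ns) = (λ ()) ∷ Compat-no-minus cs ns

PegRdLe-InGridPeg : ∀ {k α β} → PegRdLe k α → InGridPeg α β → PegRdLe k β
PegRdLe-InGridPeg {α = α} {β} (done (isId , noMinus)) (v , legal , β≡ , compat) =
  done (trans β≡ (trans (inflate-identity (isId , noMinus) legal) (cong upTo (cong length (sym β≡)))) ,
        Compat-no-minus compat (All-parentDecos (_≢ minus) α v noMinus))
PegRdLe-InGridPeg {suc k} {α} {β} (step i j i≤j rd) g@(v , legal , _) =
  step (sum (take i v)) (sum (take j v)) (sum-take-mono v i≤j) (PegRdLe-InGridPeg rd (InGridPeg-pegRev g i j i≤j))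

rev-↭ : ∀ i j (xs : Word) → i ≤ j → rev i j xs ↭ xs
rev-↭ i j xs i≤j = subst (_↭ xs) (sym (rev≡revWith-id i j xs)) (revWith-id-↭ i j xs i≤j)

IsPerm-↭ : ∀ {xs ys} → xs ↭ ys → IsPerm xs → IsPerm ys
IsPerm-↭ {xs} {ys} p q = ↭-trans (↭-sym p) (subst (λ n → xs ↭ upTo n) (↭.↭-length p) q)

RdLe⇒IsPerm : ∀ {k π} → RdLe k π → IsPerm π
RdLe⇒IsPerm (done isId) = ↭-reflexive isId
RdLe⇒IsPerm {π = π} (step i j i≤j rd) = IsPerm-↭ (rev-↭ i j π i≤j) (RdLe⇒IsPerm rd)

PegRdLe⇒IsPegPerm : ∀ {k α} → PegRdLe k α → IsPegPerm α
PegRdLe⇒IsPegPerm (done (isId , _)) = ↭-reflexive isId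
PegRdLe⇒IsPegPerm {α = α} (step i j i≤j rd) =
  IsPerm-↭ (rev-↭ i j (underlying α) i≤j) (subst IsPerm (underlying-pegRev i j α) (PegRdLe⇒IsPegPerm rd))

-- Breakpoints: the lower bound rd ≥ k

IncreasingPair DecreasingPair StripPair : ℕ × Deco → ℕ × Deco → Set
IncreasingPair x y = proj₁ y ≡ suc (proj₁ x) × IncOK (proj₂ x) × IncOK (proj₂ y)
DecreasingPair x y = proj₁ x ≡ suc (proj₁ y) × DecOK (proj₂ x) × DecOK (proj₂ y)
StripPair x y = IncreasingPair x y ⊎ DecreasingPair x y

IncOK? : ∀ d → Dec (IncOK d)
IncOK? plus = yes tt
IncOK? minus = no (λ ())
IncOK? bullet = yes tt

DecOK? : ∀ d → Dec (DecOK d)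
DecOK? plus = no (λ ())
DecOK? minus = yes tt
DecOK? bullet = yes tt

StripPair? : ∀ x y → Dec (StripPair x y)
StripPair? x y = ((proj₁ y ≟ suc (proj₁ x)) ×-dec (IncOK? (proj₂ x) ×-dec IncOK? (proj₂ y)))
           ⊎-dec ((proj₁ x ≟ suc (proj₁ y)) ×-dec (DecOK? (proj₂ x) ×-dec DecOK? (proj₂ y)))

breakpoint : ℕ × Deco → ℕ × Deco → ℕ
breakpoint x y with StripPair? x y
... | yes _ = 0
... | no _ = 1

breakpoints : PegWord → ℕ
breakpoints [] = 0
breakpoints (x ∷ []) = 0
breakpoints (x ∷ y ∷ r) = breakpoint x y + breakpoints (y ∷ r)

breakpoint≤1 : ∀ x y → breakpoint x y ≤ 1
breakpoint≤1 x y with StripPair? x y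
... | yes _ = z≤n
... | no _ = ≤-refl

breakpoint-strip : ∀ {x y} → StripPair x y → breakpoint x y ≡ 0
breakpoint-strip {x} {y} s with StripPair? x y
... | yes _ = refl
... | no ¬s = ⊥-elim (¬s s)

breakpoint-¬strip : ∀ {x y} → ¬ StripPair x y → breakpoint x y ≡ 1
breakpoint-¬strip {x} {y} ¬s with StripPair? x y
... | yes s = ⊥-elim (¬s s)
... | no _ = refl

StripPair-flip : ∀ {x y} → StripPair x y → StripPair (flipEntry y) (flipEntry x)
StripPair-flip {_ , dx} {_ , dy} (inj₁ (eq , ix , iy)) = inj₂ (eq , inc⇒dec dy iy , inc⇒dec dx ix)
  where
  inc⇒dec : ∀ d → IncOK d → DecOK (flipDeco d)
  inc⇒dec plus _ = tt
  inc⇒dec bullet _ = tt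
StripPair-flip {_ , dx} {_ , dy} (inj₂ (eq , ix , iy)) = inj₁ (eq , dec⇒inc dy iy , dec⇒inc dx ix)
  where
  dec⇒inc : ∀ d → DecOK d → IncOK (flipDeco d)
  dec⇒inc minus _ = tt
  dec⇒inc bullet _ = tt

StripPair-unflip : ∀ {x y} → StripPair (flipEntry y) (flipEntry x) → StripPair x y
StripPair-unflip {x} {y} s = subst₂ StripPair (flipEntry-involutive x) (flipEntry-involutive y) (StripPair-flip s)

breakpoint-flip : ∀ x y → breakpoint (flipEntry y) (flipEntry x) ≡ breakpoint x y
breakpoint-flip x y with StripPair? x y
... | yes s = breakpoint-strip (StripPair-flip s)
... | no ¬s = breakpoint-¬strip (λ s → ¬s (StripPair-unflip s))

flipRev : PegWord → PegWord
flipRev L = map flipEntry (reverse L)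

breakpoints-snoc : ∀ W a b → breakpoints (W ++ a ∷ b ∷ []) ≡ breakpoints (W ++ [ a ]) + breakpoint a b
breakpoints-snoc [] a b = +-identityʳ (breakpoint a b)
breakpoints-snoc (w ∷ []) a b = trans (cong (breakpoint w a +_) (+-identityʳ (breakpoint a b))) (cong (_+ breakpoint a b) (sym (+-identityʳ (breakpoint w a))))
breakpoints-snoc (w ∷ w' ∷ W) a b = trans (cong (breakpoint w w' +_) (breakpoints-snoc (w' ∷ W) a b)) (sym (+-assoc (breakpoint w w') _ (breakpoint a b)))

flipRev-snoc : ∀ S l → flipRev (S ++ [ l ]) ≡ flipEntry l ∷ flipRev S
flipRev-snoc S l = cong (map flipEntry) (reverse-++ S [ l ])

flipRev-cons : ∀ s S → flipRev (s ∷ S) ≡ flipRev S ++ [ flipEntry s ]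
flipRev-cons s S = trans (cong (map flipEntry) (unfold-reverse s S)) (map-++ flipEntry (reverse S) [ s ])

length-flipRev : ∀ L → length (flipRev L) ≡ length L
length-flipRev = length-map-reverse flipEntry

breakpoints-flipRev : ∀ L → breakpoints (flipRev L) ≡ breakpoints L
breakpoints-flipRev [] = refl
breakpoints-flipRev (x ∷ []) = refl
breakpoints-flipRev (x ∷ y ∷ L) = begin
  breakpoints (flipRev (x ∷ y ∷ L))
    ≡⟨ cong breakpoints (trans (flipRev-cons x (y ∷ L)) (cong (_++ [ flipEntry x ]) (flipRev-cons y L))) ⟩
  breakpoints ((flipRev L ++ [ flipEntry y ]) ++ [ flipEntry x ])
    ≡⟨ cong breakpoints (++-assoc (flipRev L) [ flipEntry y ] [ flipEntry x ]) ⟩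
  breakpoints (flipRev L ++ flipEntry y ∷ flipEntry x ∷ [])
    ≡⟨ breakpoints-snoc (flipRev L) (flipEntry y) (flipEntry x) ⟩
  breakpoints (flipRev L ++ [ flipEntry y ]) + breakpoint (flipEntry y) (flipEntry x)
    ≡⟨ cong₂ _+_ (trans (cong breakpoints (sym (flipRev-cons y L))) (breakpoints-flipRev (y ∷ L))) (breakpoint-flip x y) ⟩
  breakpoints (y ∷ L) + breakpoint x y
    ≡⟨ +-comm (breakpoints (y ∷ L)) (breakpoint x y) ⟩
  breakpoints (x ∷ y ∷ L) ∎
  where open ≡-Reasoning

breakpoints-++-≤ : ∀ X Y → breakpoints (X ++ Y) ≤ breakpoints X + breakpoints Y + 1
breakpoints-++-≤ [] Y = m≤m+n (breakpoints Y) 1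
breakpoints-++-≤ (x ∷ []) [] = z≤n
breakpoints-++-≤ (x ∷ []) (y ∷ Y) = ≤-trans (+-monoˡ-≤ (breakpoints (y ∷ Y)) (breakpoint≤1 x y)) (≤-reflexive (+-comm 1 (breakpoints (y ∷ Y))))
breakpoints-++-≤ (x ∷ x' ∷ X) Y = ≤-trans (+-monoʳ-≤ (breakpoint x x') (breakpoints-++-≤ (x' ∷ X) Y))
  (≤-reflexive (trans (sym (+-assoc (breakpoint x x') _ 1)) (cong (_+ 1) (sym (+-assoc (breakpoint x x') (breakpoints (x' ∷ X)) (breakpoints Y))))))

breakpoints-++-≥ : ∀ X Y → breakpoints X + breakpoints Y ≤ breakpoints (X ++ Y)
breakpoints-++-≥ [] Y = ≤-refl
breakpoints-++-≥ (x ∷ []) [] = z≤n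
breakpoints-++-≥ (x ∷ []) (y ∷ Y) = m≤n+m (breakpoints (y ∷ Y)) (breakpoint x y)
breakpoints-++-≥ (x ∷ x' ∷ X) Y = ≤-trans (≤-reflexive (+-assoc (breakpoint x x') (breakpoints (x' ∷ X)) (breakpoints Y)))
  (+-monoʳ-≤ (breakpoint x x') (breakpoints-++-≥ (x' ∷ X) Y))

-- Each of the two cut points of a reversal destroys at most one strip, and the
-- reversed factor keeps its internal strips.
breakpoints-pegRev : ∀ i j α → i ≤ j → breakpoints α ≤ breakpoints (pegRev i j α) + 2
breakpoints-pegRev i j α i≤j = begin
  breakpoints α
    ≡⟨ cong breakpoints (take++factor++drop i j α i≤j) ⟩
  breakpoints (A ++ M ++ C)
    ≤⟨ breakpoints-++-≤ A (M ++ C) ⟩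
  b A + b (M ++ C) + 1
    ≤⟨ +-monoˡ-≤ 1 (+-monoʳ-≤ (b A) (breakpoints-++-≤ M C)) ⟩
  b A + (b M + b C + 1) + 1
    ≡⟨ cong (λ z → b A + (z + b C + 1) + 1) (sym (breakpoints-flipRev M)) ⟩
  b A + (b (flipRev M) + b C + 1) + 1
    ≡⟨ rearrange (b A) (b (flipRev M)) (b C) ⟩
  b A + (b (flipRev M) + b C) + 2
    ≤⟨ +-monoˡ-≤ 2 (≤-trans (+-monoʳ-≤ (b A) (breakpoints-++-≥ (flipRev M) C)) (breakpoints-++-≥ A (flipRev M ++ C))) ⟩
  b (pegRev i j α) + 2 ∎
  where
  open ≤-Reasoning
  b = breakpoints
  A = take i α
  M = take (j ∸ i) (drop i α)
  C = drop j α
  rearrange : ∀ p q r → p + (q + r + 1) + 1 ≡ p + (q + r) + 2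
  rearrange p q r = trans (+-assoc p (q + r + 1) 1) (trans (cong (p +_) (+-assoc (q + r) 1 1)) (sym (+-assoc p (q + r) 2)))

no-minus⇒IncOK : ∀ d → d ≢ minus → IncOK d
no-minus⇒IncOK plus _ = tt
no-minus⇒IncOK minus d≢minus = ⊥-elim (d≢minus refl)
no-minus⇒IncOK bullet _ = tt

breakpoints-consecutive : ∀ {m α} → Consecutive m α → All (λ x → proj₂ x ≢ minus) α → breakpoints α ≡ 0
breakpoints-consecutive [] _ = refl
breakpoints-consecutive (_ ∷ []) _ = refl
breakpoints-consecutive {α = (a , d) ∷ (b , e) ∷ r} (refl ∷ (refl ∷ c)) (nd ∷ ne ∷ ns) =
  trans (cong (_+ breakpoints ((b , e) ∷ r)) (breakpoint-strip (inj₁ (refl , no-minus⇒IncOK d nd , no-minus⇒IncOK e ne))))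
        (breakpoints-consecutive (refl ∷ c) (ne ∷ ns))

breakpoints-identity : ∀ {α} → IsIdentityPeg α → breakpoints α ≡ 0
breakpoints-identity {α} (isId , noMinus) = breakpoints-consecutive (consecutive 0 α (length (underlying α)) isId) (All.map⁻ noMinus)

¬StripPair-clean : ∀ {x y r} → CleanCompact (x ∷ y ∷ r) → ¬ StripPair x y
¬StripPair-clean (¬inc , ¬dec , _) (inj₁ s) = ¬inc s
¬StripPair-clean (¬inc , ¬dec , _) (inj₂ s) = ¬dec s

breakpoints-clean : ∀ α → CleanCompact α → breakpoints α ≡ length α ∸ 1
breakpoints-clean [] _ = refl
breakpoints-clean (x ∷ []) _ = refl
breakpoints-clean (x ∷ y ∷ r) c@(_ , _ , c′) = cong₂ _+_ (breakpoint-¬strip (¬StripPair-clean c)) (breakpoints-clean (y ∷ r) c′)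

breakpoints-PegRdLe : ∀ {m α} → PegRdLe m α → breakpoints α ≤ 2 * m
breakpoints-PegRdLe (done isId) = subst (_≤ _) (sym (breakpoints-identity isId)) z≤n
breakpoints-PegRdLe {suc m} {α} (step i j i≤j rd) = ≤-trans (breakpoints-pegRev i j α i≤j)
  (≤-trans (+-monoˡ-≤ 2 (breakpoints-PegRdLe rd)) (≤-reflexive (trans (+-comm (2 * m) 2) (sym (*-suc 2 m)))))

PegRdLe-lower-bound : ∀ {k m α} → CleanCompact α → length α ≡ 2 * k + 1 → PegRdLe m α → k ≤ m
PegRdLe-lower-bound {k} {m} {α} c len rd = *-cancelˡ-≤ 2 (begin
  2 * k                ≡⟨ sym (m+n∸n≡m (2 * k) 1) ⟩
  2 * k + 1 ∸ 1        ≡⟨ cong (_∸ 1) (sym len) ⟩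
  length α ∸ 1         ≡⟨ sym (breakpoints-clean α c) ⟩
  breakpoints α        ≤⟨ breakpoints-PegRdLe rd ⟩
  2 * m ∎)
  where open ≤-Reasoning

data Resolves : Deco → Deco → Set where
  plus : Resolves plus plus
  minus : Resolves minus minus
  bullet+ : Resolves bullet plus
  bullet− : Resolves bullet minus

ResolvesEntry : ℕ × Deco → ℕ × Deco → Set
ResolvesEntry x y = proj₁ x ≡ proj₁ y × Resolves (proj₂ x) (proj₂ y)

_Resolves*_ : PegWord → PegWord → Set
_Resolves*_ = Pointwise ResolvesEntry

bullet↦plus : ℕ × Deco → ℕ × Deco
bullet↦plus (a , bullet) = (a , plus)
bullet↦plus x = x

Resolves*-bullet↦plus : ∀ α → α Resolves* map bullet↦plus α
Resolves*-bullet↦plus [] = []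
Resolves*-bullet↦plus ((a , plus) ∷ α) = (refl , plus) ∷ Resolves*-bullet↦plus α
Resolves*-bullet↦plus ((a , minus) ∷ α) = (refl , minus) ∷ Resolves*-bullet↦plus α
Resolves*-bullet↦plus ((a , bullet) ∷ α) = (refl , bullet+) ∷ Resolves*-bullet↦plus α

ResolvesEntry-flip : ∀ {x y} → ResolvesEntry x y → ResolvesEntry (flipEntry x) (flipEntry y)
ResolvesEntry-flip (eq , plus) = eq , minus
ResolvesEntry-flip (eq , minus) = eq , plus
ResolvesEntry-flip (eq , bullet+) = eq , bullet−
ResolvesEntry-flip (eq , bullet−) = eq , bullet+

underlying-Resolves* : ∀ {α β} → α Resolves* β → underlying α ≡ underlying β
underlying-Resolves* [] = refl
underlying-Resolves* ((eq , _) ∷ rs) = cong₂ _∷_ eq (underlying-Resolves* rs)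

no-minus-bullet↦plus : ∀ α → All (_≢ minus) (decos α) → All (_≢ minus) (decos (map bullet↦plus α))
no-minus-bullet↦plus [] [] = []
no-minus-bullet↦plus ((a , plus) ∷ α) (n ∷ ns) = n ∷ no-minus-bullet↦plus α ns
no-minus-bullet↦plus ((a , minus) ∷ α) (n ∷ ns) = n ∷ no-minus-bullet↦plus α ns
no-minus-bullet↦plus ((a , bullet) ∷ α) (n ∷ ns) = (λ ()) ∷ no-minus-bullet↦plus α ns

-- The bullets of α are resolved as they end up in the identity reached by the
-- reversals, transported back along the (involutive) reversals.
resolve-bullets : ∀ {k α} → PegRdLe k α → Σ PegWord λ β → α Resolves* β × PegRdLe k β
resolve-bullets {α = α} (done (isId , noMinus)) =
  map bullet↦plus α , Resolves*-bullet↦plus α ,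
  done (trans (sym same) (trans isId (cong (λ z → upTo (length z)) same)) , no-minus-bullet↦plus α noMinus)
  where
  same = underlying-Resolves* (Resolves*-bullet↦plus α)
resolve-bullets {suc k} {α} (step i j i≤j rd) with resolve-bullets rd
... | β , rs , rdβ =
  pegRev i j β ,
  subst (_Resolves* pegRev i j β) (pegRev-involutive i j α i≤j) (Pointwise-revWith flipEntry flipEntry ResolvesEntry-flip i j rs) ,
  step i j i≤j (subst (PegRdLe k) (sym (pegRev-involutive i j β i≤j)) rdβ)

NoBullet : PegWord → Set
NoBullet = All (λ x → proj₂ x ≢ bullet)

NoBullet-Resolves* : ∀ {α β} → α Resolves* β → NoBullet β
NoBullet-Resolves* [] = []
NoBullet-Resolves* ((_ , plus) ∷ rs) = (λ ()) ∷ NoBullet-Resolves* rs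
NoBullet-Resolves* ((_ , minus) ∷ rs) = (λ ()) ∷ NoBullet-Resolves* rs
NoBullet-Resolves* ((_ , bullet+) ∷ rs) = (λ ()) ∷ NoBullet-Resolves* rs
NoBullet-Resolves* ((_ , bullet−) ∷ rs) = (λ ()) ∷ NoBullet-Resolves* rs

CleanCompact-Resolves* : ∀ {α β} → α Resolves* β → CleanCompact α → CleanCompact β
CleanCompact-Resolves* [] c = tt
CleanCompact-Resolves* (_ ∷ []) c = tt
CleanCompact-Resolves* ((refl , r₁) ∷ (refl , r₂) ∷ rs) (¬inc , ¬dec , c) =
  (λ (eq , i₁ , i₂) → ¬inc (eq , incOK r₁ i₁ , incOK r₂ i₂)) ,
  (λ (eq , d₁ , d₂) → ¬dec (eq , decOK r₁ d₁ , decOK r₂ d₂)) ,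
  CleanCompact-Resolves* ((refl , r₂) ∷ rs) c
  where
  incOK : ∀ {d e} → Resolves d e → IncOK e → IncOK d
  incOK plus t = t
  incOK bullet+ t = tt
  decOK : ∀ {d e} → Resolves d e → DecOK e → DecOK d
  decOK minus t = t
  decOK bullet− t = tt

Legal-Resolves* : ∀ {α β v} → α Resolves* β → Legal α v → Legal β v
Legal-Resolves* [] [] = []
Legal-Resolves* ((_ , plus) ∷ rs) (l ∷ ls) = tt ∷ Legal-Resolves* rs ls
Legal-Resolves* ((_ , minus) ∷ rs) (l ∷ ls) = tt ∷ Legal-Resolves* rs ls
Legal-Resolves* ((_ , bullet+) ∷ rs) (l ∷ ls) = tt ∷ Legal-Resolves* rs ls
Legal-Resolves* ((_ , bullet−) ∷ rs) (l ∷ ls) = tt ∷ Legal-Resolves* rs ls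

offset-Resolves* : ∀ {α β} v → α Resolves* β → ∀ a → offset α v a ≡ offset β v a
offset-Resolves* v rs a = cong sum (go rs v)
  where
  go : ∀ {α β} → α Resolves* β → ∀ v → zipWith (offsetTerm a) α v ≡ zipWith (offsetTerm a) β v
  go [] v = refl
  go (_ ∷ rs) [] = refl
  go ((eq , _) ∷ rs) (w ∷ v) = cong₂ _∷_ (cong (λ z → if z <ᵇ a then w else 0) eq) (go rs v)

-- A bullet carries a block of length at most 1, where + and − agree.
inflate-Resolves* : ∀ {α β v} → α Resolves* β → Legal α v → inflate α v ≡ inflate β v
inflate-Resolves* {α} {β} {v} rs legal = cong concat (go rs legal)
  where
  sameOffset : ∀ {x y} → ResolvesEntry x y → offset α v (proj₁ x) ≡ offset β v (proj₁ y)
  sameOffset {x} (eq , _) = trans (offset-Resolves* v rs (proj₁ x)) (cong (offset β v) eq)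
  sameBlock : ∀ {x y w} → ResolvesEntry x y → LegalEntry x w → blockAt α v x w ≡ blockAt β v y w
  sameBlock {w = w} r@(_ , plus) _ = cong (λ o → block plus o w) (sameOffset r)
  sameBlock {w = w} r@(_ , minus) _ = cong (λ o → block minus o w) (sameOffset r)
  sameBlock {w = w} r@(_ , bullet+) _ = cong (λ o → block plus o w) (sameOffset r)
  sameBlock {w = zero} (_ , bullet−) _ = refl
  sameBlock {w = suc zero} r@(_ , bullet−) _ = cong (λ o → block plus o 1) (sameOffset r)
  sameBlock {w = suc (suc w)} (_ , bullet−) (s≤s ())
  go : ∀ {α′ β′ v′} → α′ Resolves* β′ → Legal α′ v′ → zipWith (blockAt α v) α′ v′ ≡ zipWith (blockAt β v) β′ v′
  go [] [] = refl
  go (r ∷ rs) (l ∷ ls) = cong₂ _∷_ (sameBlock r l) (go rs ls)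

CompatUpgrade : Deco → Deco → Set
CompatUpgrade d d′ = ∀ e → Compat d e → Compat d′ e

Pointwise-CompatUpgrade : ∀ {α β v} → α Resolves* β → Legal α v → Pointwise CompatUpgrade (parentDecos α v) (parentDecos β v)
Pointwise-CompatUpgrade [] [] = []
Pointwise-CompatUpgrade {v = w ∷ v} ((_ , r) ∷ rs) (_ ∷ ls) = Pointwise.++⁺ (Pointwise.replicate⁺ (upgrade r) w) (Pointwise-CompatUpgrade rs ls)
  where
  upgrade : ∀ {d e} → Resolves d e → CompatUpgrade d e
  upgrade plus e c = c
  upgrade minus e c = c
  upgrade bullet+ e refl = λ ()
  upgrade bullet− e refl = λ ()

InGridPeg-Resolves* : ∀ {α β δ} → α Resolves* β → InGridPeg α δ → InGridPeg β δ
InGridPeg-Resolves* rs (v , legal , δ≡ , compat) =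
  v , Legal-Resolves* rs legal , trans δ≡ (inflate-Resolves* rs legal) ,
  upgrade* (Pointwise-CompatUpgrade rs legal) compat
  where
  upgrade* : ∀ {ds ds′ es} → Pointwise CompatUpgrade ds ds′ → Pointwise Compat ds es → Pointwise Compat ds′ es
  upgrade* [] [] = []
  upgrade* (u ∷ us) (c ∷ cs) = u _ c ∷ upgrade* us cs

-- Splitting an entry: labels above the split label move up by one

shift : ℕ → ℕ → ℕ
shift x zero = zero
shift zero (suc y) = suc (suc y)
shift (suc x) (suc y) = suc (shift x y)

shiftEntry : ℕ → ℕ × Deco → ℕ × Deco
shiftEntry x q = (shift x (proj₁ q) , proj₂ q)

shift≡0 : ∀ x y → shift x y ≡ 0 → y ≡ 0
shift≡0 x zero _ = refl
shift≡0 zero (suc y) ()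
shift≡0 (suc x) (suc y) ()

shift-injective : ∀ x a b → shift x a ≡ shift x b → a ≡ b
shift-injective x zero zero eq = refl
shift-injective x zero (suc b) eq = sym (shift≡0 x (suc b) (sym eq))
shift-injective x (suc a) zero eq = shift≡0 x (suc a) eq
shift-injective zero (suc a) (suc b) eq = cong pred eq
shift-injective (suc x) (suc a) (suc b) eq = cong suc (shift-injective x a b (cong pred eq))

shift-≡suc : ∀ x a b → shift x b ≡ suc (shift x a) → b ≡ suc a
shift-≡suc x zero zero ()
shift-≡suc zero zero (suc b) ()
shift-≡suc x (suc a) zero ()
shift-≡suc (suc x) zero (suc b) eq = cong suc (shift≡0 x b (cong pred eq))
shift-≡suc zero (suc a) (suc b) eq = cong pred eq
shift-≡suc (suc x) (suc a) (suc b) eq = cong suc (shift-≡suc x a b (cong pred eq))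

shift-self : ∀ x → shift x x ≡ x
shift-self zero = refl
shift-self (suc x) = cong suc (shift-self x)

shift-suc-self : ∀ x → shift x (suc x) ≡ suc (suc x)
shift-suc-self zero = refl
shift-suc-self (suc x) = cong suc (shift-suc-self x)

shift-≤ : ∀ x y → y ≤ x → shift x y ≡ y
shift-≤ x zero _ = refl
shift-≤ (suc x) (suc y) (s≤s y≤x) = cong suc (shift-≤ x y y≤x)

shift-suc : ∀ x a → a ≢ x → shift x (suc a) ≡ suc (shift x a)
shift-suc zero zero a≢x = ⊥-elim (a≢x refl)
shift-suc zero (suc a) _ = refl
shift-suc (suc x) zero _ = refl
shift-suc (suc x) (suc a) a≢x = cong suc (shift-suc x a (λ eq → a≢x (cong suc eq)))

shift-<ᵇ-shift : ∀ x y a → (shift x y <ᵇ shift x a) ≡ (y <ᵇ a)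
shift-<ᵇ-shift x zero zero = refl
shift-<ᵇ-shift zero zero (suc a) = refl
shift-<ᵇ-shift (suc x) zero (suc a) = refl
shift-<ᵇ-shift zero (suc y) zero = refl
shift-<ᵇ-shift (suc x) (suc y) zero = refl
shift-<ᵇ-shift zero (suc y) (suc a) = refl
shift-<ᵇ-shift (suc x) (suc y) (suc a) = shift-<ᵇ-shift x y a

<ᵇ-shift : ∀ x a → (x <ᵇ shift x a) ≡ (x <ᵇ a)
<ᵇ-shift x zero = refl
<ᵇ-shift zero (suc a) = refl
<ᵇ-shift (suc x) (suc a) = <ᵇ-shift x a

suc-<ᵇ-shift : ∀ x a → (suc x <ᵇ shift x a) ≡ (x <ᵇ a)
suc-<ᵇ-shift x zero = refl
suc-<ᵇ-shift zero (suc a) = refl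
suc-<ᵇ-shift (suc x) (suc a) = suc-<ᵇ-shift x a

shift-<ᵇ-suc : ∀ x y → y ≢ x → (shift x y <ᵇ suc x) ≡ (y <ᵇ x)
shift-<ᵇ-suc zero zero y≢x = ⊥-elim (y≢x refl)
shift-<ᵇ-suc (suc x) zero _ = refl
shift-<ᵇ-suc zero (suc y) _ = refl
shift-<ᵇ-suc (suc x) (suc y) y≢x = shift-<ᵇ-suc x y (λ eq → y≢x (cong suc eq))

<ᵇ-irrefl : ∀ x → (x <ᵇ x) ≡ false
<ᵇ-irrefl zero = refl
<ᵇ-irrefl (suc x) = <ᵇ-irrefl x

<ᵇ-suc : ∀ x → (x <ᵇ suc x) ≡ true
<ᵇ-suc zero = refl
<ᵇ-suc (suc x) = <ᵇ-suc x

leftPart rightPart : ℕ × Deco → ℕ × Deco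
leftPart (x , minus) = (suc x , minus)
leftPart (x , d) = (x , d)
rightPart (x , minus) = (x , minus)
rightPart (x , d) = (suc x , d)

splitAt : PegWord → ℕ × Deco → PegWord → PegWord
splitAt X e Y = map (shiftEntry (proj₁ e)) X ++ leftPart e ∷ rightPart e ∷ map (shiftEntry (proj₁ e)) Y

data SignedStrip : ℕ × Deco → ℕ × Deco → Set where
  up : ∀ {a} → SignedStrip (a , plus) (suc a , plus)
  down : ∀ {a} → SignedStrip (suc a , minus) (a , minus)

SignedStrip-parts : ∀ e → proj₂ e ≢ bullet → SignedStrip (leftPart e) (rightPart e)
SignedStrip-parts (x , plus) _ = up
SignedStrip-parts (x , minus) _ = down
SignedStrip-parts (x , bullet) d≢bullet = ⊥-elim (d≢bullet refl)

SignedStrip-leftPart : ∀ {p e} → SignedStrip p e → SignedStrip (shiftEntry (proj₁ e) p) (leftPart e)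
SignedStrip-leftPart {a , plus} up = subst (λ u → SignedStrip (u , plus) (suc a , plus)) (sym (shift-≤ (suc a) a (n≤1+n a))) up
SignedStrip-leftPart {suc a , minus} down = subst (λ u → SignedStrip (u , minus) (suc a , minus)) (sym (shift-suc-self a)) down

SignedStrip-shift : ∀ x {p q} → SignedStrip p q → proj₁ p ≢ x → proj₁ q ≢ x → SignedStrip (shiftEntry x p) (shiftEntry x q)
SignedStrip-shift x {a , plus} up p≢x _ = subst (λ u → SignedStrip (shift x a , plus) (u , plus)) (sym (shift-suc x a p≢x)) up
SignedStrip-shift x {_ , minus} {a , minus} down _ q≢x = subst (λ u → SignedStrip (u , minus) (shift x a , minus)) (sym (shift-suc x a q≢x)) down

StripPair-shift⁻ : ∀ x {p q} → StripPair (shiftEntry x p) (shiftEntry x q) → StripPair p q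
StripPair-shift⁻ x {p} {q} (inj₁ (eq , ip , iq)) = inj₁ (shift-≡suc x (proj₁ p) (proj₁ q) eq , ip , iq)
StripPair-shift⁻ x {p} {q} (inj₂ (eq , dp , dq)) = inj₂ (shift-≡suc x (proj₁ q) (proj₁ p) eq , dp , dq)

clean-∷∷ : ∀ {x y r} → ¬ StripPair x y → CleanCompact (y ∷ r) → CleanCompact (x ∷ y ∷ r)
clean-∷∷ ¬s c = (λ s → ¬s (inj₁ s)) , (λ s → ¬s (inj₂ s)) , c

CleanCompact-++⁻ˡ : ∀ X Y → CleanCompact (X ++ Y) → CleanCompact X
CleanCompact-++⁻ˡ [] Y c = tt
CleanCompact-++⁻ˡ (x ∷ []) Y c = tt
CleanCompact-++⁻ˡ (x ∷ x′ ∷ X) Y c@(_ , _ , c′) = clean-∷∷ (¬StripPair-clean c) (CleanCompact-++⁻ˡ (x′ ∷ X) Y c′)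

CleanCompact-++⁻ʳ : ∀ X Y → CleanCompact (X ++ Y) → CleanCompact Y
CleanCompact-++⁻ʳ [] Y c = c
CleanCompact-++⁻ʳ (x ∷ []) [] c = tt
CleanCompact-++⁻ʳ (x ∷ []) (y ∷ Y) (_ , _ , c′) = c′
CleanCompact-++⁻ʳ (x ∷ x′ ∷ X) Y (_ , _ , c′) = CleanCompact-++⁻ʳ (x′ ∷ X) Y c′

CleanCompact-++⁺ : ∀ X p q Y → CleanCompact (X ++ [ p ]) → CleanCompact (q ∷ Y) → ¬ StripPair p q → CleanCompact (X ++ p ∷ q ∷ Y)
CleanCompact-++⁺ [] p q Y _ cq ¬s = clean-∷∷ ¬s cq
CleanCompact-++⁺ (x ∷ []) p q Y cp cq ¬s = clean-∷∷ (¬StripPair-clean {r = []} cp) (clean-∷∷ ¬s cq)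
CleanCompact-++⁺ (x ∷ x′ ∷ X) p q Y cp@(_ , _ , cp′) cq ¬s = clean-∷∷ (¬StripPair-clean cp) (CleanCompact-++⁺ (x′ ∷ X) p q Y cp′ cq ¬s)

CleanCompact-shift : ∀ x Z → CleanCompact Z → CleanCompact (map (shiftEntry x) Z)
CleanCompact-shift x [] c = tt
CleanCompact-shift x (z ∷ []) c = tt
CleanCompact-shift x (z ∷ z′ ∷ Z) c@(_ , _ , c′) = clean-∷∷ (λ s → ¬StripPair-clean c (StripPair-shift⁻ x s)) (CleanCompact-shift x (z′ ∷ Z) c′)

¬StripPair-leftPart : ∀ z e → proj₂ e ≢ bullet → ¬ StripPair z e → ¬ StripPair (shiftEntry (proj₁ e) z) (leftPart e)
¬StripPair-leftPart z (x , plus) _ ¬s s = ¬s (StripPair-shift⁻ x (subst (λ u → StripPair (shiftEntry x z) (u , plus)) (sym (shift-self x)) s))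
¬StripPair-leftPart z (x , minus) _ ¬s (inj₁ (_ , _ , ()))
¬StripPair-leftPart z (x , minus) _ ¬s (inj₂ (eq , dz , _)) = ¬s (inj₂ (shift-injective x (proj₁ z) (suc x) (trans eq (sym (shift-suc-self x))) , dz , tt))
¬StripPair-leftPart z (x , bullet) d≢bullet = ⊥-elim (d≢bullet refl)

¬StripPair-rightPart : ∀ e z → proj₂ e ≢ bullet → ¬ StripPair e z → ¬ StripPair (rightPart e) (shiftEntry (proj₁ e) z)
¬StripPair-rightPart (x , minus) z _ ¬s s = ¬s (StripPair-shift⁻ x (subst (λ u → StripPair (u , minus) (shiftEntry x z)) (sym (shift-self x)) s))
¬StripPair-rightPart (x , plus) z _ ¬s (inj₁ (eq , _ , iz)) = ¬s (inj₁ (shift-injective x (proj₁ z) (suc x) (trans eq (sym (shift-suc-self x))) , tt , iz))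
¬StripPair-rightPart (x , plus) z _ ¬s (inj₂ (_ , () , _))
¬StripPair-rightPart (x , bullet) z d≢bullet = ⊥-elim (d≢bullet refl)

CleanCompact-leftPart : ∀ Z e → proj₂ e ≢ bullet → CleanCompact (Z ++ [ e ]) → CleanCompact (map (shiftEntry (proj₁ e)) Z ++ [ leftPart e ])
CleanCompact-leftPart [] e _ _ = tt
CleanCompact-leftPart (z ∷ []) e d≢bullet c = clean-∷∷ {r = []} (¬StripPair-leftPart z e d≢bullet (¬StripPair-clean {r = []} c)) tt
CleanCompact-leftPart (z ∷ z′ ∷ Z) e d≢bullet c@(_ , _ , c′) =
  clean-∷∷ (λ s → ¬StripPair-clean c (StripPair-shift⁻ (proj₁ e) s)) (CleanCompact-leftPart (z′ ∷ Z) e d≢bullet c′)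

CleanCompact-rightPart : ∀ Z e → proj₂ e ≢ bullet → CleanCompact (e ∷ Z) → CleanCompact (rightPart e ∷ map (shiftEntry (proj₁ e)) Z)
CleanCompact-rightPart [] e _ _ = tt
CleanCompact-rightPart (z ∷ Z) e d≢bullet c@(_ , _ , c′) =
  clean-∷∷ (¬StripPair-rightPart e z d≢bullet (¬StripPair-clean c)) (CleanCompact-shift (proj₁ e) (z ∷ Z) c′)

breakpoints≤ : ∀ L → breakpoints L ≤ length L ∸ 1
breakpoints≤ [] = z≤n
breakpoints≤ (x ∷ []) = z≤n
breakpoints≤ (x ∷ y ∷ r) = +-mono-≤ (breakpoint≤1 x y) (breakpoints≤ (y ∷ r))

clean-breakpoints : ∀ L → breakpoints L ≡ length L ∸ 1 → CleanCompact L
clean-breakpoints [] _ = tt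
clean-breakpoints (x ∷ []) _ = tt
clean-breakpoints (x ∷ y ∷ r) eq = clean-∷∷ ¬s (clean-breakpoints (y ∷ r) (cong pred (trans (cong (_+ _) (sym (breakpoint-¬strip ¬s))) eq)))
  where
  ¬s : ¬ StripPair x y
  ¬s s = <⇒≱ (s≤s (breakpoints≤ (y ∷ r))) (≤-reflexive (trans (sym eq) (cong (_+ _) (breakpoint-strip s))))

CleanCompact-flipRev : ∀ L → CleanCompact L → CleanCompact (flipRev L)
CleanCompact-flipRev L c = clean-breakpoints (flipRev L)
  (trans (breakpoints-flipRev L) (trans (breakpoints-clean L c) (cong (_∸ 1) (sym (length-flipRev L)))))

offset-++ : ∀ X M Xv Mv → length X ≡ length Xv → ∀ a → offset (X ++ M) (Xv ++ Mv) a ≡ offset X Xv a + offset M Mv a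
offset-++ X M Xv Mv eq a = trans (cong sum (zipWith-++ (offsetTerm a) X M Xv Mv eq)) (sum-++ (zipWith (offsetTerm a) X Xv) _)

offset-shift : ∀ x a L Lv → offset (map (shiftEntry x) L) Lv (shift x a) ≡ offset L Lv a
offset-shift x a [] Lv = refl
offset-shift x a (q ∷ L) [] = refl
offset-shift x a (q ∷ L) (w ∷ Lv) = cong₂ _+_ (cong (λ b → if b then w else 0) (shift-<ᵇ-shift x (proj₁ q) a)) (offset-shift x a L Lv)

offset-shift-suc : ∀ x L Lv → All (λ q → proj₁ q ≢ x) L → offset (map (shiftEntry x) L) Lv (suc x) ≡ offset L Lv x
offset-shift-suc x [] Lv _ = refl
offset-shift-suc x (q ∷ L) [] _ = refl
offset-shift-suc x (q ∷ L) (w ∷ Lv) (q≢x ∷ L≢x) =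
  cong₂ _+_ (cong (λ b → if b then w else 0) (shift-<ᵇ-suc x (proj₁ q) q≢x)) (offset-shift-suc x L Lv L≢x)

concat-zipWith-++-∷ : ∀ {A B : Set} (F : A → ℕ → List B) (X : List A) y Y (Xv : List ℕ) w Yv → length X ≡ length Xv →
  concat (zipWith F (X ++ y ∷ Y) (Xv ++ w ∷ Yv)) ≡ concat (zipWith F X Xv) ++ F y w ++ concat (zipWith F Y Yv)
concat-zipWith-++-∷ F X y Y Xv w Yv eq = trans (cong concat (zipWith-++ F X (y ∷ Y) Xv (w ∷ Yv) eq)) (sym (concat-++ (zipWith F X Xv) _))

applyUpTo-+-++ : ∀ o a b → applyUpTo (o +_) a ++ applyUpTo ((o + a) +_) b ≡ applyUpTo (o +_) (a + b)
applyUpTo-+-++ o a b = trans (cong (applyUpTo (o +_) a ++_) (applyUpTo-cong (+-assoc o a) b)) (applyUpTo-++ (o +_) a b)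

replicate-++ : ∀ {A : Set} m n (x : A) → replicate (m + n) x ≡ replicate m x ++ replicate n x
replicate-++ zero n x = refl
replicate-++ (suc m) n x = cong (x ∷_) (replicate-++ m n x)

-- The weight of the part labelled x rather than x + 1.
lowerWeight : ℕ × Deco → ℕ → ℕ → ℕ
lowerWeight (_ , minus) t w = w ∸ t
lowerWeight _ t w = t

module _ {t w : ℕ} (t≤w : t ≤ w) where

  private
    if-split : ∀ b → (if b then t else 0) + (if b then w ∸ t else 0) ≡ (if b then w else 0)
    if-split true = m+[n∸m]≡n t≤w
    if-split false = refl

  offsetTerm-parts : ∀ e → proj₂ e ≢ bullet → ∀ a →
    offsetTerm (shift (proj₁ e) a) (leftPart e) t + offsetTerm (shift (proj₁ e) a) (rightPart e) (w ∸ t) ≡ offsetTerm a e w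
  offsetTerm-parts (x , plus) _ a rewrite <ᵇ-shift x a | suc-<ᵇ-shift x a = if-split (x <ᵇ a)
  offsetTerm-parts (x , minus) _ a rewrite <ᵇ-shift x a | suc-<ᵇ-shift x a = if-split (x <ᵇ a)
  offsetTerm-parts (x , bullet) d≢bullet = ⊥-elim (d≢bullet refl)

  offsetTerm-parts-suc : ∀ e → proj₂ e ≢ bullet →
    offsetTerm (suc (proj₁ e)) (leftPart e) t + offsetTerm (suc (proj₁ e)) (rightPart e) (w ∸ t) ≡ lowerWeight e t w
  offsetTerm-parts-suc (x , plus) _ rewrite <ᵇ-suc x | <ᵇ-irrefl (suc x) = +-identityʳ t
  offsetTerm-parts-suc (x , minus) _ rewrite <ᵇ-suc x | <ᵇ-irrefl (suc x) = refl
  offsetTerm-parts-suc (x , bullet) d≢bullet = ⊥-elim (d≢bullet refl)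

  blocks-parts : ∀ e → proj₂ e ≢ bullet → ∀ (O : ℕ → ℕ) o → O (proj₁ e) ≡ o → O (suc (proj₁ e)) ≡ o + lowerWeight e t w →
    block (proj₂ (leftPart e)) (O (proj₁ (leftPart e))) t ++ block (proj₂ (rightPart e)) (O (proj₁ (rightPart e))) (w ∸ t) ≡ block (proj₂ e) o w
  blocks-parts (x , plus) _ O o Ox≡o Osx≡ rewrite Ox≡o | Osx≡ =
    trans (applyUpTo-+-++ o t (w ∸ t)) (cong (applyUpTo (o +_)) (m+[n∸m]≡n t≤w))
  blocks-parts (x , minus) _ O o Ox≡o Osx≡ rewrite Ox≡o | Osx≡ = begin
    reverse (applyUpTo ((o + (w ∸ t)) +_) t) ++ reverse (applyUpTo (o +_) (w ∸ t))
      ≡⟨ sym (reverse-++ (applyUpTo (o +_) (w ∸ t)) _) ⟩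
    reverse (applyUpTo (o +_) (w ∸ t) ++ applyUpTo ((o + (w ∸ t)) +_) t)
      ≡⟨ cong reverse (trans (applyUpTo-+-++ o (w ∸ t) t) (cong (applyUpTo (o +_)) (m∸n+n≡m t≤w))) ⟩
    reverse (applyUpTo (o +_) w) ∎
    where open ≡-Reasoning
  blocks-parts (x , bullet) d≢bullet = ⊥-elim (d≢bullet refl)

  parentBlock-parts : ∀ e → proj₂ e ≢ bullet → parentBlock (leftPart e) t ++ parentBlock (rightPart e) (w ∸ t) ≡ parentBlock e w
  parentBlock-parts (x , plus) _ = trans (sym (replicate-++ t (w ∸ t) plus)) (cong (λ n → replicate n plus) (m+[n∸m]≡n t≤w))
  parentBlock-parts (x , minus) _ = trans (sym (replicate-++ t (w ∸ t) minus)) (cong (λ n → replicate n minus) (m+[n∸m]≡n t≤w))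
  parentBlock-parts (x , bullet) d≢bullet = ⊥-elim (d≢bullet refl)

  LegalEntry-parts : ∀ e → proj₂ e ≢ bullet → LegalEntry (leftPart e) t × LegalEntry (rightPart e) (w ∸ t)
  LegalEntry-parts (x , plus) _ = tt , tt
  LegalEntry-parts (x , minus) _ = tt , tt
  LegalEntry-parts (x , bullet) d≢bullet = ⊥-elim (d≢bullet refl)

zipWith-mapˡ : ∀ {A B C : Set} (F : A → B → C) (g : A → A) xs ys → zipWith F (map g xs) ys ≡ zipWith (λ x y → F (g x) y) xs ys
zipWith-mapˡ F g [] ys = refl
zipWith-mapˡ F g (x ∷ xs) [] = refl
zipWith-mapˡ F g (x ∷ xs) (y ∷ ys) = cong (F (g x) y ∷_) (zipWith-mapˡ F g xs ys)

module SplitBlock (X Y : PegWord) (e : ℕ × Deco) (e≢bullet : proj₂ e ≢ bullet)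
  (Xv Yv : List ℕ) {t w : ℕ} (t≤w : t ≤ w) (lengthX : length X ≡ length Xv) where

  private
    x = proj₁ e
    α = X ++ e ∷ Y
    v = Xv ++ w ∷ Yv
    α₂ = splitAt X e Y
    v₂ = Xv ++ t ∷ (w ∸ t) ∷ Yv
    shifted : PegWord → PegWord
    shifted = map (shiftEntry x)
    lengthX₂ : length (shifted X) ≡ length Xv
    lengthX₂ = trans (length-map (shiftEntry x) X) lengthX
    T₁ T₂ : ℕ → ℕ
    T₁ a = offsetTerm a (leftPart e) t
    T₂ a = offsetTerm a (rightPart e) (w ∸ t)

    offset₂ : ∀ a → offset α₂ v₂ a ≡ offset (shifted X) Xv a + ((T₁ a + T₂ a) + offset (shifted Y) Yv a)
    offset₂ a = trans (offset-++ (shifted X) (leftPart e ∷ rightPart e ∷ shifted Y) Xv (t ∷ (w ∸ t) ∷ Yv) lengthX₂ a) (cong (offset (shifted X) Xv a +_) (sym (+-assoc (T₁ a) (T₂ a) _)))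

  offset-splitAt-shift : ∀ a → offset α₂ v₂ (shift x a) ≡ offset α v a
  offset-splitAt-shift a = begin
    offset α₂ v₂ (shift x a)
      ≡⟨ offset₂ (shift x a) ⟩
    offset (shifted X) Xv (shift x a) + ((T₁ (shift x a) + T₂ (shift x a)) + offset (shifted Y) Yv (shift x a))
      ≡⟨ cong₂ (λ p q → p + q) (offset-shift x a X Xv) (cong₂ _+_ (offsetTerm-parts t≤w e e≢bullet a) (offset-shift x a Y Yv)) ⟩
    offset X Xv a + (offsetTerm a e w + offset Y Yv a)
      ≡⟨ sym (offset-++ X (e ∷ Y) Xv (w ∷ Yv) lengthX a) ⟩
    offset α v a ∎
    where open ≡-Reasoning

  module _ (X≢x : All (λ q → proj₁ q ≢ x) X) (Y≢x : All (λ q → proj₁ q ≢ x) Y) where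

    offset-splitAt-suc : offset α₂ v₂ (suc x) ≡ offset α v x + lowerWeight e t w
    offset-splitAt-suc = begin
      offset α₂ v₂ (suc x)
        ≡⟨ offset₂ (suc x) ⟩
      offset (shifted X) Xv (suc x) + ((T₁ (suc x) + T₂ (suc x)) + offset (shifted Y) Yv (suc x))
        ≡⟨ cong₂ (λ p q → p + q) (offset-shift-suc x X Xv X≢x) (cong₂ _+_ (offsetTerm-parts-suc t≤w e e≢bullet) (offset-shift-suc x Y Yv Y≢x)) ⟩
      P + (W + Q)
        ≡⟨ trans (cong (P +_) (+-comm W Q)) (sym (+-assoc P Q W)) ⟩
      P + Q + W
        ≡⟨ cong (λ z → P + (z + Q) + W) (sym (cong (λ b → if b then w else 0) (<ᵇ-irrefl x))) ⟩
      P + (offsetTerm x e w + Q) + W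
        ≡⟨ cong (_+ W) (sym (offset-++ X (e ∷ Y) Xv (w ∷ Yv) lengthX x)) ⟩
      offset α v x + W ∎
      where
      open ≡-Reasoning
      P = offset X Xv x
      Q = offset Y Yv x
      W = lowerWeight e t w

    inflate-splitAt : inflate α₂ v₂ ≡ inflate α v
    inflate-splitAt = begin
      concat (zipWith B₂ (shifted X ++ leftPart e ∷ rightPart e ∷ shifted Y) v₂)
        ≡⟨ concat-zipWith-++-∷ B₂ (shifted X) (leftPart e) (rightPart e ∷ shifted Y) Xv t ((w ∸ t) ∷ Yv) lengthX₂ ⟩
      concat (zipWith B₂ (shifted X) Xv) ++ B₂ (leftPart e) t ++ B₂ (rightPart e) (w ∸ t) ++ concat (zipWith B₂ (shifted Y) Yv)
        ≡⟨ cong₂ _++_ (blocks-shifted X Xv) (trans (sym (++-assoc (B₂ (leftPart e) t) _ _)) (cong₂ _++_ parts (blocks-shifted Y Yv))) ⟩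
      concat (zipWith B X Xv) ++ B e w ++ concat (zipWith B Y Yv)
        ≡⟨ sym (concat-zipWith-++-∷ B X e Y Xv w Yv lengthX) ⟩
      inflate α v ∎
      where
      open ≡-Reasoning
      B₂ = blockAt α₂ v₂
      B = blockAt α v
      blocks-shifted : ∀ L Lv → concat (zipWith B₂ (shifted L) Lv) ≡ concat (zipWith B L Lv)
      blocks-shifted L Lv = cong concat (trans (zipWith-mapˡ B₂ (shiftEntry x) L Lv)
        (zipWith-cong (λ q u → cong (λ o → block (proj₂ q) o u) (offset-splitAt-shift (proj₁ q))) L Lv))
      parts : B₂ (leftPart e) t ++ B₂ (rightPart e) (w ∸ t) ≡ B e w
      parts = blocks-parts t≤w e e≢bullet (offset α₂ v₂) (offset α v x)
        (trans (cong (offset α₂ v₂) (sym (shift-self x))) (offset-splitAt-shift x)) offset-splitAt-suc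

  parentDecos-splitAt : parentDecos α₂ v₂ ≡ parentDecos α v
  parentDecos-splitAt = begin
    concat (zipWith parentBlock (shifted X ++ leftPart e ∷ rightPart e ∷ shifted Y) v₂)
      ≡⟨ concat-zipWith-++-∷ parentBlock (shifted X) (leftPart e) (rightPart e ∷ shifted Y) Xv t ((w ∸ t) ∷ Yv) lengthX₂ ⟩
    concat (zipWith parentBlock (shifted X) Xv) ++ parentBlock (leftPart e) t ++ parentBlock (rightPart e) (w ∸ t) ++ concat (zipWith parentBlock (shifted Y) Yv)
      ≡⟨ cong₂ _++_ (parents-shifted X Xv) (trans (sym (++-assoc (parentBlock (leftPart e) t) _ _))
           (cong₂ _++_ (parentBlock-parts t≤w e e≢bullet) (parents-shifted Y Yv))) ⟩
    concat (zipWith parentBlock X Xv) ++ parentBlock e w ++ concat (zipWith parentBlock Y Yv)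
      ≡⟨ sym (concat-zipWith-++-∷ parentBlock X e Y Xv w Yv lengthX) ⟩
    parentDecos α v ∎
    where
    open ≡-Reasoning
    parents-shifted : ∀ L Lv → concat (zipWith parentBlock (shifted L) Lv) ≡ concat (zipWith parentBlock L Lv)
    parents-shifted L Lv = cong concat (zipWith-mapˡ parentBlock (shiftEntry x) L Lv)

  Legal-splitAt : Legal α v → Legal α₂ v₂
  Legal-splitAt legal =
    let (legalX , _ , legalY) = Pointwise-++-∷ X e Y Xv w Yv lengthX legal
        (legalLeft , legalRight) = LegalEntry-parts t≤w e e≢bullet
    in Pointwise.++⁺ (legal-shifted legalX) (legalLeft ∷ legalRight ∷ legal-shifted legalY)
    where
    legal-shifted : ∀ {L Lv} → Legal L Lv → Legal (shifted L) Lv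
    legal-shifted [] = []
    legal-shifted {(_ , plus) ∷ _} (l ∷ ls) = l ∷ legal-shifted ls
    legal-shifted {(_ , minus) ∷ _} (l ∷ ls) = l ∷ legal-shifted ls
    legal-shifted {(_ , bullet) ∷ _} (l ∷ ls) = l ∷ legal-shifted ls

  sum-splitAt : sum v₂ ≡ sum v
  sum-splitAt = trans (sum-++ Xv _) (trans (cong (sum Xv +_) (trans (sym (+-assoc t (w ∸ t) (sum Yv))) (cong (_+ sum Yv) (m+[n∸m]≡n t≤w))))
    (sym (sum-++ Xv _)))

-- The splitting is itself a peg inflation (doubling the split entry)

indicator : ℕ → ℕ → ℕ
indicator a y = if y <ᵇ a then 1 else 0

sum-indicator-upTo : ∀ a n → sum (map (indicator a) (upTo n)) ≡ a ⊓ n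
sum-indicator-upTo a zero = sym (⊓-zeroʳ a)
sum-indicator-upTo a (suc n) = begin
  sum (map (indicator a) (upTo (suc n)))             ≡⟨ cong (λ L → sum (map (indicator a) L)) (sym (applyUpTo-∷ʳ (λ y → y) n)) ⟩
  sum (map (indicator a) (upTo n ++ [ n ]))          ≡⟨ cong sum (map-++ (indicator a) (upTo n) [ n ]) ⟩
  sum (map (indicator a) (upTo n) ++ [ indicator a n ]) ≡⟨ sum-++ (map (indicator a) (upTo n)) _ ⟩
  sum (map (indicator a) (upTo n)) + (indicator a n + 0) ≡⟨ cong₂ _+_ (sum-indicator-upTo a n) (+-identityʳ _) ⟩
  a ⊓ n + indicator a n                              ≡⟨ last a n ⟩
  a ⊓ suc n ∎
  where
  open ≡-Reasoning
  last : ∀ a n → a ⊓ n + indicator a n ≡ a ⊓ suc n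
  last a n with ≤-<-connex a n
  ... | inj₁ a≤n rewrite <ᵇ-false n a a≤n | m≤n⇒m⊓n≡m a≤n | m≤n⇒m⊓n≡m (m≤n⇒m≤1+n a≤n) = +-identityʳ a
  ... | inj₂ n<a rewrite <ᵇ-true n a n<a | m≥n⇒m⊓n≡n (<⇒≤ n<a) | m≥n⇒m⊓n≡n n<a = +-comm n 1

offset-ones : ∀ a (L : PegWord) → offset L (replicate (length L) 1) a ≡ sum (map (indicator a) (underlying L))
offset-ones a [] = refl
offset-ones a (q ∷ L) = cong (indicator a (proj₁ q) +_) (offset-ones a L)

offset-ones-perm : ∀ {α} → IsPegPerm α → ∀ a → offset α (replicate (length α) 1) a ≡ a ⊓ length α
offset-ones-perm {α} perm a = begin
  offset α (replicate (length α) 1) a          ≡⟨ offset-ones a α ⟩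
  sum (map (indicator a) (underlying α))       ≡⟨ sum-↭ (↭.map⁺ (indicator a) perm) ⟩
  sum (map (indicator a) (upTo (length (underlying α)))) ≡⟨ sum-indicator-upTo a _ ⟩
  a ⊓ length (underlying α)                    ≡⟨ cong (a ⊓_) (length-map proj₁ α) ⟩
  a ⊓ length α ∎
  where open ≡-Reasoning

shift≡+indicator : ∀ x a → shift x a ≡ a + indicator a x
shift≡+indicator x zero = refl
shift≡+indicator zero (suc a) = cong suc (+-comm 1 a)
shift≡+indicator (suc x) (suc a) = cong suc (shift≡+indicator x a)

labels<length : ∀ {α} → IsPegPerm α → All (λ q → proj₁ q < length α) α
labels<length {α} perm = All.map⁻ (subst (λ n → All (_< n) (underlying α)) (length-map proj₁ α)
  (↭.All-resp-↭ (↭-sym perm) (All.applyUpTo⁺₁ (λ y → y) (length (underlying α)) (λ lt → lt))))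

Unique-resp-↭ : ∀ {xs ys : List ℕ} → xs ↭ ys → AllPairs _≢_ ys → AllPairs _≢_ xs
Unique-resp-↭ _↭_.refl u = u
Unique-resp-↭ (_↭_.prep x p) (a ∷ u) = ↭.All-resp-↭ (↭-sym p) a ∷ Unique-resp-↭ p u
Unique-resp-↭ (_↭_.swap x y p) ((x≢y ∷ a₁) ∷ a₂ ∷ u) =
  ((λ eq → x≢y (sym eq)) ∷ ↭.All-resp-↭ (↭-sym p) a₂) ∷ ↭.All-resp-↭ (↭-sym p) a₁ ∷ Unique-resp-↭ p u
Unique-resp-↭ (_↭_.trans p q) u = Unique-resp-↭ p (Unique-resp-↭ q u)

labels-unique : ∀ {α} → IsPegPerm α → AllPairs _≢_ (underlying α)
labels-unique perm = Unique-resp-↭ perm (Unique.upTo⁺ _)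

AllPairs-++⁻ˡ : ∀ (X Y : List ℕ) → AllPairs _≢_ (X ++ Y) → AllPairs _≢_ X
AllPairs-++⁻ˡ [] Y u = []
AllPairs-++⁻ˡ (x ∷ X) Y (a ∷ u) = All.++⁻ˡ X a ∷ AllPairs-++⁻ˡ X Y u

AllPairs-++⁻ʳ : ∀ (X Y : List ℕ) → AllPairs _≢_ (X ++ Y) → AllPairs _≢_ Y
AllPairs-++⁻ʳ [] Y u = u
AllPairs-++⁻ʳ (x ∷ X) Y (_ ∷ u) = AllPairs-++⁻ʳ X Y u

AllPairs-middle : ∀ (X : List ℕ) y Y → AllPairs _≢_ (X ++ y ∷ Y) → All (_≢ y) X × All (_≢ y) Y
AllPairs-middle [] y Y (a ∷ _) = [] , All.map (λ y≢z z≡y → y≢z (sym z≡y)) a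
AllPairs-middle (x ∷ X) y Y (a ∷ u) with All.++⁻ʳ X a | AllPairs-middle X y Y u
... | x≢y ∷ _ | X≢y , Y≢y = x≢y ∷ X≢y , Y≢y

AllPairs-underlying-middle : ∀ P M Q → AllPairs _≢_ (underlying (P ++ M ++ Q)) → AllPairs _≢_ (underlying M)
AllPairs-underlying-middle P M Q unique = AllPairs-++⁻ˡ (underlying M) (underlying Q) (AllPairs-++⁻ʳ (underlying P) _
  (subst (AllPairs _≢_) (trans (map-++ proj₁ P (M ++ Q)) (cong (underlying P ++_) (map-++ proj₁ M Q))) unique))

labels-≢-split : ∀ X e Y → IsPegPerm (X ++ e ∷ Y) → All (λ q → proj₁ q ≢ proj₁ e) X × All (λ q → proj₁ q ≢ proj₁ e) Y
labels-≢-split X e Y perm with AllPairs-middle (underlying X) (proj₁ e) (underlying Y)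
  (subst (AllPairs _≢_) (map-++ proj₁ X (e ∷ Y)) (labels-unique perm))
... | X≢x , Y≢x = All.map⁻ X≢x , All.map⁻ Y≢x

module Doubling (X Y : PegWord) (e : ℕ × Deco) (e≢bullet : proj₂ e ≢ bullet) (perm : IsPegPerm (X ++ e ∷ Y)) where

  private
    x = proj₁ e
    α = X ++ e ∷ Y
    n = length α
    ones : PegWord → List ℕ
    ones L = replicate (length L) 1
    u = ones X ++ 2 ∷ ones Y
    lengthX : length X ≡ length (ones X)
    lengthX = sym (length-replicate (length X))

  offset-doubling : ∀ a → a ≤ n → offset α u a ≡ shift x a
  offset-doubling a a≤n = begin
    offset α u a
      ≡⟨ offset-++ X (e ∷ Y) (ones X) (2 ∷ ones Y) lengthX a ⟩
    P + (offsetTerm a e 2 + Q)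
      ≡⟨ cong (λ z → P + (z + Q)) (double (x <ᵇ a)) ⟩
    P + ((offsetTerm a e 1 + indicator a x) + Q)
      ≡⟨ rearrange P (offsetTerm a e 1) (indicator a x) Q ⟩
    P + (offsetTerm a e 1 + Q) + indicator a x
      ≡⟨ cong (_+ indicator a x) (sym (offset-++ X (e ∷ Y) (ones X) (1 ∷ ones Y) lengthX a)) ⟩
    offset α (ones X ++ 1 ∷ ones Y) a + indicator a x
      ≡⟨ cong (λ z → offset α z a + indicator a x) (sym (trans (cong (λ m → replicate m 1) (length-++ X)) (replicate-++ (length X) _ 1))) ⟩
    offset α (ones α) a + indicator a x
      ≡⟨ cong (_+ indicator a x) (trans (offset-ones-perm perm a) (m≤n⇒m⊓n≡m a≤n)) ⟩
    a + indicator a x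
      ≡⟨ sym (shift≡+indicator x a) ⟩
    shift x a ∎
    where
    open ≡-Reasoning
    P = offset X (ones X) a
    Q = offset Y (ones Y) a
    double : ∀ b → (if b then 2 else 0) ≡ (if b then 1 else 0) + (if b then 1 else 0)
    double true = refl
    double false = refl
    rearrange : ∀ p q r s → p + ((q + r) + s) ≡ (p + (q + s)) + r
    rearrange p q r s = trans (cong (p +_) (trans (+-assoc q r s) (trans (cong (q +_) (+-comm r s)) (sym (+-assoc q s r)))))
      (sym (+-assoc p (q + s) r))

  private
    labels< : All (λ q → proj₁ q < n) α
    labels< = labels<length perm

    singletons : ∀ L → All (λ q → proj₁ q < n) L → concat (zipWith (blockAt α u) L (ones L)) ≡ underlying (map (shiftEntry x) L)
    singletons [] _ = refl
    singletons (q ∷ L) (q<n ∷ L<n) =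
      cong₂ _++_ (trans (block-1 (proj₂ q) _) (cong [_] (offset-doubling (proj₁ q) (<⇒≤ q<n)))) (singletons L L<n)
      where
      block-1 : ∀ d o → block d o 1 ≡ [ o ]
      block-1 plus o = cong [_] (+-identityʳ o)
      block-1 minus o = cong [_] (+-identityʳ o)
      block-1 bullet o = cong [_] (+-identityʳ o)

    x<n : x < n
    x<n with All.++⁻ʳ X labels<
    ... | x<n ∷ _ = x<n

    doubled : blockAt α u e 2 ≡ proj₁ (leftPart e) ∷ proj₁ (rightPart e) ∷ []
    doubled = block-doubled e e≢bullet (trans (offset-doubling x (<⇒≤ x<n)) (shift-self x))
      where
      block-doubled : ∀ e → proj₂ e ≢ bullet → ∀ {o} → o ≡ proj₁ e → block (proj₂ e) o 2 ≡ proj₁ (leftPart e) ∷ proj₁ (rightPart e) ∷ []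
      block-doubled (x , plus) _ refl = cong₂ (λ p q → p ∷ q ∷ []) (+-identityʳ x) (+-comm x 1)
      block-doubled (x , minus) _ refl = cong₂ (λ p q → p ∷ q ∷ []) (+-comm x 1) (+-identityʳ x)
      block-doubled (x , bullet) d≢bullet = ⊥-elim (d≢bullet refl)

    legal : Legal α u
    legal = Pointwise.++⁺ (legal-ones X) (legal-double e e≢bullet ∷ legal-ones Y)
      where
      legal-ones : ∀ L → Legal L (ones L)
      legal-ones [] = []
      legal-ones ((_ , plus) ∷ L) = tt ∷ legal-ones L
      legal-ones ((_ , minus) ∷ L) = tt ∷ legal-ones L
      legal-ones ((_ , bullet) ∷ L) = ≤-refl ∷ legal-ones L
      legal-double : ∀ e → proj₂ e ≢ bullet → LegalEntry e 2
      legal-double (_ , plus) _ = tt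
      legal-double (_ , minus) _ = tt
      legal-double (_ , bullet) d≢bullet = ⊥-elim (d≢bullet refl)

    underlying-splitAt : underlying (splitAt X e Y) ≡ inflate α u
    underlying-splitAt = begin
      underlying (map (shiftEntry x) X ++ leftPart e ∷ rightPart e ∷ map (shiftEntry x) Y)
        ≡⟨ map-++ proj₁ (map (shiftEntry x) X) _ ⟩
      underlying (map (shiftEntry x) X) ++ (proj₁ (leftPart e) ∷ proj₁ (rightPart e) ∷ []) ++ underlying (map (shiftEntry x) Y)
        ≡⟨ sym (cong₂ _++_ (singletons X (All.++⁻ˡ X labels<)) (cong₂ _++_ doubled (singletons Y labels<Y))) ⟩
      concat (zipWith (blockAt α u) X (ones X)) ++ blockAt α u e 2 ++ concat (zipWith (blockAt α u) Y (ones Y))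
        ≡⟨ sym (concat-zipWith-++-∷ (blockAt α u) X e Y (ones X) 2 (ones Y) lengthX) ⟩
      inflate α u ∎
      where
      open ≡-Reasoning
      labels<Y : All (λ q → proj₁ q < n) Y
      labels<Y with All.++⁻ʳ X labels<
      ... | _ ∷ Y<n = Y<n

    parentDecos-doubling : parentDecos α u ≡ decos (splitAt X e Y)
    parentDecos-doubling = begin
      parentDecos α u
        ≡⟨ concat-zipWith-++-∷ parentBlock X e Y (ones X) 2 (ones Y) lengthX ⟩
      concat (zipWith parentBlock X (ones X)) ++ parentBlock e 2 ++ concat (zipWith parentBlock Y (ones Y))
        ≡⟨ cong₂ _++_ (parents-ones X) (cong₂ _++_ (parents-double e e≢bullet) (parents-ones Y)) ⟩
      decos (map (shiftEntry x) X) ++ (proj₂ (leftPart e) ∷ proj₂ (rightPart e) ∷ []) ++ decos (map (shiftEntry x) Y)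
        ≡⟨ sym (map-++ proj₂ (map (shiftEntry x) X) _) ⟩
      decos (splitAt X e Y) ∎
      where
      open ≡-Reasoning
      parents-ones : ∀ L → concat (zipWith parentBlock L (ones L)) ≡ decos (map (shiftEntry x) L)
      parents-ones [] = refl
      parents-ones (q ∷ L) = cong (proj₂ q ∷_) (parents-ones L)
      parents-double : ∀ e → proj₂ e ≢ bullet → parentBlock e 2 ≡ proj₂ (leftPart e) ∷ proj₂ (rightPart e) ∷ []
      parents-double (_ , plus) _ = refl
      parents-double (_ , minus) _ = refl
      parents-double (_ , bullet) d≢bullet = ⊥-elim (d≢bullet refl)

    Compat-refl : ∀ ds → Pointwise Compat ds ds
    Compat-refl [] = []
    Compat-refl (plus ∷ ds) = (λ ()) ∷ Compat-refl ds
    Compat-refl (minus ∷ ds) = (λ ()) ∷ Compat-refl ds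
    Compat-refl (bullet ∷ ds) = refl ∷ Compat-refl ds

  InGridPeg-splitAt : InGridPeg α (splitAt X e Y)
  InGridPeg-splitAt = u , legal , underlying-splitAt ,
    subst (λ ds → Pointwise Compat ds (decos (splitAt X e Y))) (sym parentDecos-doubling) (Compat-refl _)

-- Covering a reversal by splitting the two blocks containing its cut points

record Covering (k : ℕ) (α : PegWord) (v : List ℕ) (δ : PegWord) : Set where
  field
    rd : PegRdLe k α
    noBullet : NoBullet α
    legal : Legal α v
    inflates : underlying δ ≡ inflate α v
    compatible : Pointwise Compat (parentDecos α v) (decos δ)

  grid : InGridPeg α δ
  grid = v , legal , inflates , compatible

NoBullet-splitAt : ∀ X e Y → NoBullet (X ++ e ∷ Y) → NoBullet (splitAt X e Y)
NoBullet-splitAt X (x , d) Y noBullet with All.++⁻ X noBullet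
... | noBulletX , d≢bullet ∷ noBulletY =
  All.++⁺ (All.map⁺ noBulletX) (proj₁ (parts d d≢bullet) ∷ proj₂ (parts d d≢bullet) ∷ All.map⁺ noBulletY)
  where
  parts : ∀ d → d ≢ bullet → proj₂ (leftPart (x , d)) ≢ bullet × proj₂ (rightPart (x , d)) ≢ bullet
  parts plus _ = (λ ()) , (λ ())
  parts minus _ = (λ ()) , (λ ())
  parts bullet d≢bullet = ⊥-elim (d≢bullet refl)

NoBullet-middle : ∀ X e Y → NoBullet (X ++ e ∷ Y) → proj₂ e ≢ bullet
NoBullet-middle X e Y noBullet with All.++⁻ʳ X noBullet
... | e≢bullet ∷ _ = e≢bullet

Covering-splitAt : ∀ {k δ} X e Y Xv Yv {t w} → t ≤ w → length X ≡ length Xv →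
  Covering k (X ++ e ∷ Y) (Xv ++ w ∷ Yv) δ → Covering k (splitAt X e Y) (Xv ++ t ∷ (w ∸ t) ∷ Yv) δ
Covering-splitAt {δ = δ} X e Y Xv Yv t≤w lengthX cov = record
  { rd = PegRdLe-InGridPeg rd (Doubling.InGridPeg-splitAt X Y e e≢bullet perm)
  ; noBullet = NoBullet-splitAt X e Y noBullet
  ; legal = Legal-splitAt legal
  ; inflates = trans inflates (sym (inflate-splitAt X≢x Y≢x))
  ; compatible = subst (λ ds → Pointwise Compat ds (decos δ)) (sym parentDecos-splitAt) compatible
  }
  where
  open Covering cov
  perm = PegRdLe⇒IsPegPerm rd
  e≢bullet = NoBullet-middle X e Y noBullet
  open SplitBlock X Y e e≢bullet Xv Yv t≤w lengthX
  X≢x = proj₁ (labels-≢-split X e Y perm)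
  Y≢x = proj₂ (labels-≢-split X e Y perm)

record Cut (α : PegWord) (v : List ℕ) (i : ℕ) : Set where
  field
    X Y : PegWord
    e : ℕ × Deco
    Xv Yv : List ℕ
    w t : ℕ
    α≡ : α ≡ X ++ e ∷ Y
    v≡ : v ≡ Xv ++ w ∷ Yv
    lengthX : length X ≡ length Xv
    t≤w : t ≤ w
    i≡ : i ≡ sum Xv + t

cut : ∀ {α v} i → length α ≡ length v → 0 < length α → i ≤ sum v → Cut α v i
cut {q ∷ α} {w ∷ v} i lengths _ i≤ with ≤-<-connex i w
... | inj₁ i≤w = record { X = [] ; Y = α ; e = q ; Xv = [] ; Yv = v ; w = w ; t = i
                        ; α≡ = refl ; v≡ = refl ; lengthX = refl ; t≤w = i≤w ; i≡ = refl }
cut {q ∷ []} {w ∷ []} i lengths _ i≤ | inj₂ w<i = ⊥-elim (<⇒≱ w<i (subst (i ≤_) (+-identityʳ w) i≤))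
cut {q ∷ q′ ∷ α} {w ∷ w′ ∷ v} i lengths _ i≤ | inj₂ w<i = record
  { X = q ∷ X ; Y = Y ; e = e ; Xv = w ∷ Xv ; Yv = Yv ; w = w″ ; t = t
  ; α≡ = cong (q ∷_) α≡ ; v≡ = cong (w ∷_) v≡ ; lengthX = cong suc lengthX ; t≤w = t≤w
  ; i≡ = trans (sym (m+[n∸m]≡n (<⇒≤ w<i))) (trans (cong (w +_) i≡) (sym (+-assoc w (sum Xv) t)))
  }
  where
  rest≤ : i ∸ w ≤ sum (w′ ∷ v)
  rest≤ = +-cancelˡ-≤ w (i ∸ w) (sum (w′ ∷ v)) (subst (_≤ w + sum (w′ ∷ v)) (sym (m+[n∸m]≡n (<⇒≤ w<i))) i≤)
  open Cut (cut {q′ ∷ α} {w′ ∷ v} (i ∸ w) (cong pred lengths) (s≤s z≤n) rest≤) renaming (w to w″)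

¬StripPair-flipʳ : ∀ {p l} → SignedStrip p l → ¬ StripPair p (flipEntry l)
¬StripPair-flipʳ up (inj₁ (_ , _ , ()))
¬StripPair-flipʳ up (inj₂ (_ , () , _))
¬StripPair-flipʳ down (inj₁ (_ , () , _))
¬StripPair-flipʳ down (inj₂ (_ , _ , ()))

¬StripPair-flipʳ-≢ : ∀ {p s} l → SignedStrip p s → proj₁ l ≢ proj₁ s → ¬ StripPair p (flipEntry l)
¬StripPair-flipʳ-≢ l up l≢s (inj₁ (eq , _ , _)) = l≢s eq
¬StripPair-flipʳ-≢ l up l≢s (inj₂ (_ , () , _))
¬StripPair-flipʳ-≢ l down l≢s (inj₁ (_ , () , _))
¬StripPair-flipʳ-≢ l down l≢s (inj₂ (eq , _ , _)) = l≢s (sym (cong pred eq))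

¬StripPair-flipˡ : ∀ {l q} → SignedStrip l q → ¬ StripPair (flipEntry l) q
¬StripPair-flipˡ up (inj₁ (_ , () , _))
¬StripPair-flipˡ up (inj₂ (_ , _ , ()))
¬StripPair-flipˡ down (inj₁ (_ , _ , ()))
¬StripPair-flipˡ down (inj₂ (_ , () , _))

¬StripPair-flipˡ-≢ : ∀ s {l q} → SignedStrip l q → proj₁ s ≢ proj₁ l → ¬ StripPair (flipEntry s) q
¬StripPair-flipˡ-≢ s up s≢l (inj₁ (eq , _ , _)) = s≢l (sym (cong pred eq))
¬StripPair-flipˡ-≢ s up s≢l (inj₂ (_ , _ , ()))
¬StripPair-flipˡ-≢ s down s≢l (inj₁ (_ , _ , ()))
¬StripPair-flipˡ-≢ s down s≢l (inj₂ (eq , _ , _)) = s≢l eq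

headOr : PegWord → ℕ × Deco → ℕ × Deco
headOr [] l = l
headOr (s ∷ _) l = s

-- After the reversal, the ends of the reversed factor meet p and q. They formed
-- signed strips with p and q before, so the flipped decorations cannot continue a
-- strip, and distinctness of labels excludes the other neighbours.
CleanCompact-flipRev-between : ∀ A p S l q C → CleanCompact (A ++ [ p ]) → CleanCompact (S ++ [ l ]) → CleanCompact (q ∷ C) →
  SignedStrip p (headOr S l) → SignedStrip l q → AllPairs _≢_ (underlying (S ++ [ l ])) →
  CleanCompact (A ++ p ∷ (flipRev (S ++ [ l ]) ++ q ∷ C))
CleanCompact-flipRev-between A p [] l q C cleanA _ cleanC p⋯l l⋯q _ =
  CleanCompact-++⁺ A p (flipEntry l) (q ∷ C) cleanA (clean-∷∷ (¬StripPair-flipˡ l⋯q) cleanC) (¬StripPair-flipʳ p⋯l)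
CleanCompact-flipRev-between A p (s ∷ S) l q C cleanA cleanS cleanC p⋯s l⋯q (s≢ ∷ _) =
  subst (λ z → CleanCompact (A ++ p ∷ (z ++ q ∷ C))) (sym reversed)
    (CleanCompact-++⁺ A p (flipEntry l) ((flipRev S ++ [ flipEntry s ]) ++ q ∷ C) cleanA inner (¬StripPair-flipʳ-≢ l p⋯s (λ eq → s≢l (sym eq))))
  where
  s≢l : proj₁ s ≢ proj₁ l
  s≢l with All.++⁻ʳ (underlying S) (subst (All (proj₁ s ≢_)) (map-++ proj₁ S [ l ]) s≢)
  ... | s≢l ∷ _ = s≢l
  reversed : flipRev (s ∷ S ++ [ l ]) ≡ flipEntry l ∷ (flipRev S ++ [ flipEntry s ])
  reversed = trans (flipRev-snoc (s ∷ S) l) (cong (flipEntry l ∷_) (flipRev-cons s S))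
  inner : CleanCompact (flipEntry l ∷ (flipRev S ++ [ flipEntry s ]) ++ q ∷ C)
  inner = subst CleanCompact (cong (flipEntry l ∷_) (sym (++-assoc (flipRev S) [ flipEntry s ] (q ∷ C))))
    (CleanCompact-++⁺ (flipEntry l ∷ flipRev S) (flipEntry s) q C
      (subst CleanCompact reversed (CleanCompact-flipRev (s ∷ S ++ [ l ]) cleanS)) cleanC (¬StripPair-flipˡ-≢ s l⋯q s≢l))

Covering-reverse-blocks : ∀ {k δ} P M Q vP vM vQ → length P ≡ length vP → length M ≡ length vM →
  Covering k (P ++ M ++ Q) (vP ++ vM ++ vQ) δ →
  PegRdLe (suc k) (P ++ flipRev M ++ Q) × InGridPeg (P ++ flipRev M ++ Q) (pegRev (sum vP) (sum vP + sum vM) δ)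
Covering-reverse-blocks {k} {δ} P M Q vP vM vQ lengthP lengthM cov =
  step a b a≤b (subst (PegRdLe k) (sym (trans (cong (pegRev a b) (sym reversed)) (pegRev-involutive a b (P ++ M ++ Q) a≤b))) rd) ,
  subst₂ InGridPeg reversed (cong₂ (λ c d → pegRev c d δ) sum-a sum-b) (InGridPeg-pegRev grid a b a≤b)
  where
  open Covering cov
  a = length P
  b = a + length M
  a≤b : a ≤ b
  a≤b = m≤m+n a (length M)
  reversed : pegRev a b (P ++ M ++ Q) ≡ P ++ flipRev M ++ Q
  reversed = revWith-++ flipEntry P M Q
  sum-a : sum (take a (vP ++ vM ++ vQ)) ≡ sum vP
  sum-a = cong sum (trans (cong (λ n → take n (vP ++ vM ++ vQ)) lengthP) (take-length-++ vP (vM ++ vQ)))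
  sum-b : sum (take b (vP ++ vM ++ vQ)) ≡ sum vP + sum vM
  sum-b = trans (cong sum (trans (cong (λ n → take n (vP ++ vM ++ vQ)) (cong₂ _+_ lengthP lengthM))
    (trans (cong (take (length vP + length vM)) (sym (++-assoc vP vM vQ)))
      (trans (cong (λ n → take n ((vP ++ vM) ++ vQ)) (sym (length-++ vP))) (take-length-++ (vP ++ vM) vQ)))))
    (sum-++ vP vM)

CleanCompact-splitAt-halves : ∀ X e Y → proj₂ e ≢ bullet → CleanCompact (X ++ e ∷ Y) →
  CleanCompact (map (shiftEntry (proj₁ e)) X ++ [ leftPart e ]) × CleanCompact (rightPart e ∷ map (shiftEntry (proj₁ e)) Y)
CleanCompact-splitAt-halves X e Y e≢bullet clean =
  CleanCompact-leftPart X e e≢bullet (CleanCompact-++⁻ˡ (X ++ [ e ]) Y (subst CleanCompact (sym (++-assoc X [ e ] Y)) clean)) ,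
  CleanCompact-rightPart Y e e≢bullet (CleanCompact-++⁻ʳ X (e ∷ Y) clean)

length-splitAt : ∀ X e Y → length (splitAt X e Y) ≡ suc (length (X ++ e ∷ Y))
length-splitAt X e Y = begin
  length (map (shiftEntry (proj₁ e)) X ++ _)   ≡⟨ length-++ (map (shiftEntry (proj₁ e)) X) ⟩
  length (map (shiftEntry (proj₁ e)) X) + suc (suc (length (map (shiftEntry (proj₁ e)) Y)))
    ≡⟨ cong₂ (λ a b → a + suc (suc b)) (length-map _ X) (length-map _ Y) ⟩
  length X + suc (suc (length Y))               ≡⟨ +-suc (length X) (suc (length Y)) ⟩
  suc (length X + suc (length Y))               ≡⟨ cong suc (sym (length-++ X)) ⟩
  suc (length (X ++ e ∷ Y)) ∎
  where open ≡-Reasoning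

length-flipRev-middle : ∀ P M Q → length (P ++ flipRev M ++ Q) ≡ length (P ++ M ++ Q)
length-flipRev-middle P M Q = trans (length-++-++ P (flipRev M) Q)
  (trans (cong (λ n → length P + (n + length Q)) (length-flipRev M)) (sym (length-++-++ P M Q)))

-- The left part of the first split entry is followed, in the second split, either by
-- the left part of the second split entry or by an entry of the same signed strip.
SignedStrip-after-first-split : ∀ e → proj₂ e ≢ bullet → ∀ X′ e′ Y′ Y₀ → rightPart e ∷ Y₀ ≡ X′ ++ e′ ∷ Y′ →
  All (λ q → proj₁ q ≢ proj₁ e′) (leftPart e ∷ X′) →
  SignedStrip (shiftEntry (proj₁ e′) (leftPart e)) (headOr (map (shiftEntry (proj₁ e′)) X′) (leftPart e′))
SignedStrip-after-first-split e e≢bullet [] e′ Y′ Y₀ eq _ =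
  SignedStrip-leftPart (subst (SignedStrip (leftPart e)) (∷-injectiveˡ eq) (SignedStrip-parts e e≢bullet))
SignedStrip-after-first-split e e≢bullet (z ∷ X′) e′ Y′ Y₀ eq (left≢ ∷ z≢ ∷ _) =
  SignedStrip-shift (proj₁ e′) (subst (SignedStrip (leftPart e)) (∷-injectiveˡ eq) (SignedStrip-parts e e≢bullet)) left≢ z≢

IsGenerator : ℕ → PegWord → Set
IsGenerator k α = CleanCompact α × length α ≡ 2 * k + 1 × PegRdLe k α

length-snoc : ∀ {A B : Set} (xs : List A) (ys : List B) {x y} → length xs ≡ length ys → length (xs ++ [ x ]) ≡ length (ys ++ [ y ])
length-snoc xs ys eq = trans (length-++ xs) (trans (cong (_+ 1) eq) (sym (length-++ ys)))

++-reassoc : ∀ {A : Set} (P : List A) p S l Q → (P ++ p ∷ S) ++ l ∷ Q ≡ (P ++ [ p ]) ++ (S ++ [ l ]) ++ Q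
++-reassoc P p S l Q = trans (++-assoc P (p ∷ S) (l ∷ Q))
  (trans (cong (λ z → P ++ p ∷ z) (sym (++-assoc S [ l ] Q))) (sym (++-assoc P [ p ] ((S ++ [ l ]) ++ Q))))

CleanCompact-two-splits : ∀ X e Y X′ e′ Y′ → proj₂ e ≢ bullet → proj₂ e′ ≢ bullet → CleanCompact (X ++ e ∷ Y) →
  rightPart e ∷ map (shiftEntry (proj₁ e)) Y ≡ X′ ++ e′ ∷ Y′ →
  All (λ q → proj₁ q ≢ proj₁ e′) (leftPart e ∷ X′) →
  AllPairs _≢_ (underlying (map (shiftEntry (proj₁ e′)) X′ ++ [ leftPart e′ ])) →
  let sh′ = map (shiftEntry (proj₁ e′)) in
  CleanCompact ((sh′ (map (shiftEntry (proj₁ e)) X) ++ [ shiftEntry (proj₁ e′) (leftPart e) ])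
                ++ flipRev (sh′ X′ ++ [ leftPart e′ ]) ++ rightPart e′ ∷ sh′ Y′)
CleanCompact-two-splits X e Y X′ e′ Y′ e≢bullet e′≢bullet clean B≡ distinct unique =
  subst CleanCompact (sym (++-assoc A [ p ] _))
    (CleanCompact-flipRev-between A p S (leftPart e′) (rightPart e′) (map (shiftEntry x′) Y′) cleanA cleanS cleanC
      (SignedStrip-after-first-split e e≢bullet X′ e′ Y′ _ B≡ distinct) (SignedStrip-parts e′ e′≢bullet) unique)
  where
  x′ = proj₁ e′
  A = map (shiftEntry x′) (map (shiftEntry (proj₁ e)) X)
  p = shiftEntry x′ (leftPart e)
  S = map (shiftEntry x′) X′
  first = CleanCompact-splitAt-halves X e Y e≢bullet clean
  second = CleanCompact-splitAt-halves X′ e′ Y′ e′≢bullet (subst CleanCompact B≡ (proj₂ first))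
  cleanA : CleanCompact (A ++ [ p ])
  cleanA = subst CleanCompact (map-++ (shiftEntry x′) (map (shiftEntry (proj₁ e)) X) [ leftPart e ])
    (CleanCompact-shift x′ _ (proj₁ first))
  cleanS = proj₁ second
  cleanC = proj₂ second

module _ {k : ℕ} {δ : PegWord} (X Y : PegWord) (e : ℕ × Deco) (Xv Yv : List ℕ) {t w : ℕ} (t≤w : t ≤ w)
  (lengthX : length X ≡ length Xv) (clean : CleanCompact (X ++ e ∷ Y)) (len : length (X ++ e ∷ Y) ≡ 2 * k + 1)
  (cov : Covering k (X ++ e ∷ Y) (Xv ++ w ∷ Yv) δ) where

  private
    x = proj₁ e
    e≢bullet = NoBullet-middle X e Y (Covering.noBullet cov)
    B : PegWord
    B = rightPart e ∷ map (shiftEntry x) Y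
    vB : List ℕ
    vB = (w ∸ t) ∷ Yv
    cov₂ : Covering k (map (shiftEntry x) X ++ leftPart e ∷ B) (Xv ++ t ∷ vB) δ
    cov₂ = Covering-splitAt X e Y Xv Yv t≤w lengthX cov
    lengthB : length B ≡ length vB
    lengthB = cong suc (trans (length-map (shiftEntry x) Y) (Pointwise-length (proj₂ (proj₂ (Pointwise-++-∷ X e Y Xv w Yv lengthX (Covering.legal cov))))))
    sum-prefix : sum (Xv ++ [ t ]) ≡ sum Xv + t
    sum-prefix = trans (sum-++ Xv [ t ]) (cong (sum Xv +_) (+-identityʳ t))

  cover-second-cut : ∀ {j} → sum Xv + t ≤ j → j ≤ sum (Xv ++ w ∷ Yv) →
    Σ PegWord λ γ → IsGenerator (suc k) γ × InGridPeg γ (pegRev (sum Xv + t) j δ)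
  cover-second-cut {j} i≤j j≤ with cut {B} {vB} (j ∸ (sum Xv + t)) lengthB (s≤s z≤n) bound
    where
    bound : j ∸ (sum Xv + t) ≤ sum vB
    bound = subst (j ∸ (sum Xv + t) ≤_) (m+n∸m≡n (sum Xv + t) (sum vB)) (∸-monoˡ-≤ (sum Xv + t) (subst (j ≤_) sums j≤))
      where
      sums : sum (Xv ++ w ∷ Yv) ≡ sum Xv + t + sum vB
      sums = trans (sym (SplitBlock.sum-splitAt X Y e e≢bullet Xv Yv t≤w lengthX))
        (trans (cong sum (sym (++-assoc Xv [ t ] vB))) (trans (sum-++ (Xv ++ [ t ]) vB) (cong (_+ sum vB) sum-prefix)))
  ... | record { X = X′ ; Y = Y′ ; e = e′ ; Xv = Xv′ ; Yv = Yv′ ; w = w′ ; t = t′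
               ; α≡ = B≡ ; v≡ = vB≡ ; lengthX = lengthX′ ; t≤w = t′≤w′ ; i≡ = j∸i≡ } =
    γ , (cleanγ , lengthγ , rdγ) , subst (InGridPeg γ) (cong₂ (λ a b → pegRev a b δ) sum-prefix sum-j) gridγ
    where
    x′ = proj₁ e′
    sh′ = map (shiftEntry x′)
    X₂ = map (shiftEntry x) X ++ leftPart e ∷ X′
    Xv₂ = Xv ++ t ∷ Xv′
    A = sh′ (map (shiftEntry x) X)
    p = shiftEntry x′ (leftPart e)
    S = sh′ X′
    Q = rightPart e′ ∷ sh′ Y′
    vQ = (w′ ∸ t′) ∷ Yv′
    lengthX₂ : length X₂ ≡ length Xv₂
    lengthX₂ = trans (length-++ (map (shiftEntry x) X)) (trans (cong₂ (λ a b → a + suc b) (trans (length-map _ X) lengthX) lengthX′) (sym (length-++ Xv)))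
    α₂≡ : map (shiftEntry x) X ++ leftPart e ∷ B ≡ X₂ ++ e′ ∷ Y′
    α₂≡ = trans (cong (λ z → map (shiftEntry x) X ++ leftPart e ∷ z) B≡) (sym (++-assoc (map (shiftEntry x) X) (leftPart e ∷ X′) (e′ ∷ Y′)))
    v₂≡ : Xv ++ t ∷ vB ≡ Xv₂ ++ w′ ∷ Yv′
    v₂≡ = trans (cong (λ z → Xv ++ t ∷ z) vB≡) (sym (++-assoc Xv (t ∷ Xv′) (w′ ∷ Yv′)))
    cov₃ = Covering-splitAt X₂ e′ Y′ Xv₂ Yv′ t′≤w′ lengthX₂ (subst₂ (λ a b → Covering k a b δ) α₂≡ v₂≡ cov₂)
    α₃≡ : splitAt X₂ e′ Y′ ≡ (A ++ [ p ]) ++ (S ++ [ leftPart e′ ]) ++ Q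
    α₃≡ = trans (cong (_++ leftPart e′ ∷ Q) (map-++ (shiftEntry x′) (map (shiftEntry x) X) (leftPart e ∷ X′))) (++-reassoc A p S (leftPart e′) Q)
    reversal = Covering-reverse-blocks (A ++ [ p ]) (S ++ [ leftPart e′ ]) Q (Xv ++ [ t ]) (Xv′ ++ [ t′ ]) vQ
      (length-snoc A Xv (trans (length-map _ (map (shiftEntry x) X)) (trans (length-map _ X) lengthX)))
      (length-snoc S Xv′ (trans (length-map _ X′) lengthX′))
      (subst₂ (λ a b → Covering k a b δ) α₃≡ (++-reassoc Xv t Xv′ t′ vQ) cov₃)
    γ = (A ++ [ p ]) ++ flipRev (S ++ [ leftPart e′ ]) ++ Q
    rdγ = proj₁ reversal
    gridγ = proj₂ reversal
    sum-j : sum (Xv ++ [ t ]) + sum (Xv′ ++ [ t′ ]) ≡ j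
    sum-j = trans (cong₂ _+_ sum-prefix (trans (trans (sum-++ Xv′ [ t′ ]) (cong (sum Xv′ +_) (+-identityʳ t′))) (sym j∸i≡)))
      (m+[n∸m]≡n i≤j)
    cleanγ : CleanCompact γ
    cleanγ = CleanCompact-two-splits X e Y X′ e′ Y′ e≢bullet (NoBullet-middle X₂ e′ Y′ (subst NoBullet α₂≡ (Covering.noBullet cov₂))) clean B≡
      (All.++⁻ʳ (map (shiftEntry x) X) (proj₁ (labels-≢-split X₂ e′ Y′ (PegRdLe⇒IsPegPerm (subst (PegRdLe k) α₂≡ (Covering.rd cov₂))))))
      (AllPairs-underlying-middle (A ++ [ p ]) (S ++ [ leftPart e′ ]) Q
        (labels-unique (PegRdLe⇒IsPegPerm (subst (PegRdLe k) α₃≡ (Covering.rd cov₃)))))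
    lengthγ : length γ ≡ 2 * suc k + 1
    lengthγ = begin
      length γ                                          ≡⟨ length-flipRev-middle (A ++ [ p ]) (S ++ [ leftPart e′ ]) Q ⟩
      length ((A ++ [ p ]) ++ (S ++ [ leftPart e′ ]) ++ Q) ≡⟨ cong length (sym α₃≡) ⟩
      length (splitAt X₂ e′ Y′)                         ≡⟨ length-splitAt X₂ e′ Y′ ⟩
      suc (length (X₂ ++ e′ ∷ Y′))                      ≡⟨ cong (λ z → suc (length z)) (sym α₂≡) ⟩
      suc (length (splitAt X e Y))                      ≡⟨ cong suc (length-splitAt X e Y) ⟩
      suc (suc (length (X ++ e ∷ Y)))                   ≡⟨ cong (λ n → suc (suc n)) len ⟩
      suc (suc (2 * k + 1))                             ≡⟨ cong (_+ 1) (sym (*-suc 2 k)) ⟩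
      2 * suc k + 1 ∎
      where open ≡-Reasoning


cover-resolved : ∀ {k β v δ} → CleanCompact β → length β ≡ 2 * k + 1 → Covering k β v δ → ∀ {i j} → i ≤ j → j ≤ sum v →
  Σ PegWord λ γ → IsGenerator (suc k) γ × InGridPeg γ (pegRev i j δ)
cover-resolved {k} {β} {v} {δ} clean len cov {i} {j} i≤j j≤ =
  subst (λ a → Σ PegWord λ γ → IsGenerator (suc k) γ × InGridPeg γ (pegRev a j δ)) (sym i≡)
    (cover-second-cut X Y e Xv Yv t≤w lengthX (subst CleanCompact α≡ clean) (trans (cong length (sym α≡)) len)
      (subst₂ (λ a b → Covering k a b δ) α≡ v≡ cov) (subst (_≤ j) i≡ i≤j) (subst (λ u → j ≤ sum u) v≡ j≤))
  where
  0<length : 0 < length β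
  0<length = subst (0 <_) (trans (+-comm 1 (2 * k)) (sym len)) (s≤s z≤n)
  open Cut (cut {β} {v} i (Pointwise-length (Covering.legal cov)) 0<length (≤-trans i≤j j≤))

cover-reversal : ∀ {k α δ} → IsGenerator k α → InGridPeg α δ → ∀ i j → i ≤ j →
  Σ PegWord λ γ → IsGenerator (suc k) γ × InGridPeg γ (pegRev i j δ)
cover-reversal {k} {α} {δ} (clean , len , rd) grid i j i≤j =
  subst (λ ε → Σ PegWord λ γ → IsGenerator (suc k) γ × InGridPeg γ ε) (sym (revWith-⊓-length flipEntry i j δ i≤j))
    (cover-resolved (CleanCompact-Resolves* resolves clean) (trans (sym (Pointwise-length resolves)) len) covering
      (⊓-monoˡ-≤ N i≤j) (subst (j ⊓ N ≤_) N≡sum (m⊓n≤n j N)))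
  where
  N = length δ
  resolved = resolve-bullets rd
  β = proj₁ resolved
  resolves = proj₁ (proj₂ resolved)
  gridβ = InGridPeg-Resolves* resolves grid
  v = proj₁ gridβ
  covering : Covering k β v δ
  covering = record { rd = proj₂ (proj₂ resolved) ; noBullet = NoBullet-Resolves* resolves
                    ; legal = proj₁ (proj₂ gridβ) ; inflates = proj₁ (proj₂ (proj₂ gridβ)) ; compatible = proj₂ (proj₂ (proj₂ gridβ)) }
  N≡sum : N ≡ sum v
  N≡sum = trans (sym (length-map proj₁ δ)) (trans (cong length (Covering.inflates covering))
    (length-concat-zipWith (blockAt β v) (λ x w → length-block (proj₂ x) _ w) (Covering.legal covering)))

generator₀ : PegWord
generator₀ = (0 , plus) ∷ []

IsGenerator-generator₀ : IsGenerator 0 generator₀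
IsGenerator-generator₀ = tt , refl , done (refl , (λ ()) ∷ [])

InGridPeg-generator₀ : ∀ {β} → IsIdentityPeg β → InGridPeg generator₀ β
InGridPeg-generator₀ {β} (isId , noMinus) =
  length β ∷ [] , tt ∷ [] ,
  trans isId (trans (cong upTo (length-map proj₁ β)) (sym (++-identityʳ _))) ,
  subst (λ ds → Pointwise Compat ds (decos β)) (trans (cong (λ n → replicate n plus) (length-map proj₂ β)) (sym (++-identityʳ _)))
    (plus-compatible (decos β) noMinus)
  where
  plus-compatible : ∀ ds → All (_≢ minus) ds → Pointwise Compat (replicate (length ds) plus) ds
  plus-compatible [] [] = []
  plus-compatible (d ∷ ds) (d≢minus ∷ noMinus) = d≢minus ∷ plus-compatible ds noMinus


cover : ∀ {k β} → PegRdLe k β → Σ PegWord λ α → IsGenerator k α × InGridPeg α β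
cover {zero} (done isId) = generator₀ , IsGenerator-generator₀ , InGridPeg-generator₀ isId
cover {suc k} {β} (done isId) = cover-reversal (proj₁ (proj₂ previous)) (proj₂ (proj₂ previous)) 0 0 z≤n
  where
  previous = cover {k} {β} (done isId)
cover {suc k} {β} (step i j i≤j rd) = proj₁ next , proj₁ (proj₂ next) , subst (InGridPeg (proj₁ next)) (pegRev-involutive i j β i≤j) (proj₂ (proj₂ next))
  where
  previous = cover rd
  next = cover-reversal (proj₁ (proj₂ previous)) (proj₂ (proj₂ previous)) i j i≤j

_≟ᴰ_ : (d e : Deco) → Dec (d ≡ e)
plus ≟ᴰ plus = yes refl
plus ≟ᴰ minus = no (λ ())
plus ≟ᴰ bullet = no (λ ())
minus ≟ᴰ plus = no (λ ())
minus ≟ᴰ minus = yes refl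
minus ≟ᴰ bullet = no (λ ())
bullet ≟ᴰ plus = no (λ ())
bullet ≟ᴰ minus = no (λ ())
bullet ≟ᴰ bullet = yes refl

IsIdentityPeg? : ∀ α → Dec (IsIdentityPeg α)
IsIdentityPeg? α = ≡-dec _≟_ (underlying α) (upTo (length (underlying α))) ×-dec all? (λ d → ¬? (d ≟ᴰ minus)) (decos α)

CleanCompact? : ∀ α → Dec (CleanCompact α)
CleanCompact? [] = yes tt
CleanCompact? (x ∷ []) = yes tt
CleanCompact? ((a , d) ∷ (b , e) ∷ r) =
  ¬? ((b ≟ suc a) ×-dec (IncOK? d ×-dec IncOK? e)) ×-dec (¬? ((a ≟ suc b) ×-dec (DecOK? d ×-dec DecOK? e)) ×-dec CleanCompact? ((b , e) ∷ r))

-- Reversal bounds beyond the length act like the length itself, so only finitely many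
-- reversals need to be tried.
PegRdLe? : ∀ k α → Dec (PegRdLe k α)
PegRdLe? k α with IsIdentityPeg? α
... | yes isId = yes (done isId)
PegRdLe? zero α | no ¬isId = no λ { (done isId) → ¬isId isId }
PegRdLe? (suc k) α | no ¬isId
  with any? (λ (i , j) → (i ≤? j) ×-dec PegRdLe? k (pegRev i j α)) (cartesianProduct (upTo (suc (length α))) (upTo (suc (length α))))
... | no none = no impossible
  where
  n = length α
  impossible : ¬ PegRdLe (suc k) α
  impossible (done isId) = ¬isId isId
  impossible (step i j i≤j rd) = none (lose
    (∈.∈-cartesianProduct⁺ (∈.∈-upTo⁺ (s≤s (m⊓n≤n i n))) (∈.∈-upTo⁺ (s≤s (m⊓n≤n j n))))
    (⊓-monoˡ-≤ n i≤j , subst (PegRdLe k) (revWith-⊓-length flipEntry i j α i≤j) rd))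
... | yes found with satisfied found
...   | _ , i≤j , rd = yes (step _ _ i≤j rd)

IsGenerator? : ∀ k α → Dec (IsGenerator k α)
IsGenerator? k α = CleanCompact? α ×-dec ((length α ≟ 2 * k + 1) ×-dec PegRdLe? k α)

pegWords : ℕ → ℕ → List PegWord
pegWords zero m = [] ∷ []
pegWords (suc n) m = cartesianProductWith _∷_ (cartesianProduct (upTo m) (plus ∷ minus ∷ bullet ∷ [])) (pegWords n m)

∈-pegWords : ∀ n m (α : PegWord) → length α ≡ n → All (λ q → proj₁ q < m) α → α ∈ pegWords n m
∈-pegWords zero m [] _ _ = here refl
∈-pegWords (suc n) m ((a , d) ∷ α) eq (a<m ∷ α<m) =
  ∈.∈-cartesianProductWith⁺ _∷_ (∈.∈-cartesianProduct⁺ (∈.∈-upTo⁺ a<m) (∈-decorations d)) (∈-pegWords n m α (cong pred eq) α<m)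
  where
  ∈-decorations : ∀ d → d ∈ plus ∷ minus ∷ bullet ∷ []
  ∈-decorations plus = here refl
  ∈-decorations minus = there (here refl)
  ∈-decorations bullet = there (there (here refl))

generators : ℕ → List PegWord
generators k = filter (IsGenerator? k) (pegWords (2 * k + 1) (2 * k + 1))

All-generators : ∀ k → All (IsGenerator k) (generators k)
All-generators k = All.all-filter (IsGenerator? k) (pegWords (2 * k + 1) (2 * k + 1))

∈-generators : ∀ {k α} → IsGenerator k α → α ∈ generators k
∈-generators {k} {α} g@(_ , len , rd) = ∈.∈-filter⁺ (IsGenerator? k)
  (∈-pegWords (2 * k + 1) (2 * k + 1) α len (subst (λ n → All (λ q → proj₁ q < n) α) len (labels<length (PegRdLe⇒IsPegPerm rd)))) g

-- Standard permutations as peg permutations decorated by bullets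

bulleted : Word → PegWord
bulleted = map (_, bullet)

underlying-bulleted : ∀ π → underlying (bulleted π) ≡ π
underlying-bulleted π = trans (sym (map-∘ π)) (map-id π)

PegRdLe-bulleted : ∀ {k π} → RdLe k π → PegRdLe k (bulleted π)
PegRdLe-bulleted {π = π} (done isId) =
  done (trans (underlying-bulleted π) (trans isId (cong (λ ρ → upTo (length ρ)) (sym (underlying-bulleted π)))) ,
        All.map⁺ (All.map⁺ (All.universal (λ _ ()) π)))
PegRdLe-bulleted {suc k} {π} (step i j i≤j rd) = step i j i≤j (subst (PegRdLe k) bulleted-rev (PegRdLe-bulleted rd))
  where
  bulleted-rev : bulleted (rev i j π) ≡ pegRev i j (bulleted π)
  bulleted-rev = trans (cong bulleted (rev≡revWith-id i j π)) (map-revWith (_, bullet) (λ a → a) flipEntry (λ _ → refl) i j π)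

generator-properties : ∀ {k α} → IsGenerator k α → IsPegPerm α × CleanCompact α × length α ≡ 2 * k + 1 × PegRdEq k α
generator-properties (clean , len , rd) =
  PegRdLe⇒IsPegPerm rd , clean , len , rd , λ m m<k rdm → <⇒≱ m<k (PegRdLe-lower-bound clean len rdm)

rd-of-generators : ∀ {k α} → α ∈ generators k → PegRdLe k α
rd-of-generators {k} α∈ = proj₂ (proj₂ (All.lookup (All-generators k) α∈))

InBHat⇔grids : ∀ k β → InBHat k β ⇔ Any (λ α → InGridPeg α β) (generators k)
InBHat⇔grids k β = mk⇔ to from
  where
  to : InBHat k β → Any (λ α → InGridPeg α β) (generators k)
  to (_ , rd) with cover rd
  ... | α , generator , grid = lose (∈-generators generator) grid
  from : Any (λ α → InGridPeg α β) (generators k) → InBHat k β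
  from inGrids with find inGrids
  ... | α , α∈ , grid = let rd = PegRdLe-InGridPeg (rd-of-generators α∈) grid in PegRdLe⇒IsPegPerm rd , rd

InB⇔grids : ∀ k π → InB k π ⇔ Any (λ α → InGrid α π) (generators k)
InB⇔grids k π = mk⇔ to from
  where
  to : InB k π → Any (λ α → InGrid α π) (generators k)
  to (_ , rd) with cover (PegRdLe-bulleted rd)
  ... | α , generator , (v , legal , π≡ , _) = lose (∈-generators generator) (v , legal , trans (sym (underlying-bulleted π)) π≡)
  from : Any (λ α → InGrid α π) (generators k) → InB k π
  from inGrids with find inGrids
  ... | α , α∈ , (v , legal , π≡) = let rd = subst (RdLe k) (sym π≡) (RdLe-inflate (rd-of-generators α∈) legal) in RdLe⇒IsPerm rd , rd

mainTheorem1 : (k : ℕ) → 1 ≤ k →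
    ∃ λ (αs : List PegWord) →
      All (λ α → IsPegPerm α × CleanCompact α × length α ≡ 2 * k + 1 × PegRdEq k α) αs
      × (∀ (π : Word) → InB k π ⇔ Any (λ α → InGrid α π) αs)
      × (∀ (β : PegWord) → InBHat k β ⇔ Any (λ α → InGridPeg α β) αs)
mainTheorem1 k _ = generators k , All.map generator-properties (All-generators k) , InB⇔grids k , InBHat⇔grids k
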